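{- ${\rm CLU\#P_{free}}\cap\text{0-1-F}={\rm CLU\#P}\cap\text{0-1-F}$, where $\text{0-1-F}$ denotes the class of all total functions from $\Sigma^*$ to $\{0,1\}$.
   Context: Alphabet $\Sigma=\{0,1\}$; NPTM = nondeterministic polynomial-time Turing machine. For a polynomial $p$, an NPTM $M$ is $p$-balanced if on every input $x$ its computation paths correspond exactly to the guess strings in $\{0,1\}^{p(|x|)}$; paths are identified with guess strings. $\mathrm{acc}_M(x)$ is the set of accepting paths, $\#\mathrm{acc}_M(x)$ its size. ${\rm FP}_{\rm t}$: total polynomial-time computable functions. For same-length strings, $a\prec_{\rm lex}b$ means $b$ is the immediate lexicographic successor of $a$; $\le_{\rm lex}$ is lexicographic order. ${\rm CLU\#P}$: total $f:\Sigma^*\to\mathbb{N}$ such that there exist a polynomial $p$, a $p$-balanced NPTM $M$, $b,t\in{\rm FP}_{\rm t}$ and a polynomial-time 3-argument predicate $\prec$ such that for every $x$ there is a bijection $h_x$ of $\Sigma^{p(|x|)}$ with: $|b(x)|=|t(x)|=p(|x|)$; $h_x(b(x))=0^{p(|x|)}$, $h_x(t(x))=1^{p(|x|)}$; (adjacency) for $y,z\in\{0,1\}^{p(|x|)}$, $\prec(x,y,z)$ iff $h_x(y)\prec_{\rm lex}h_x(z)$; (cluster) if $f(x)\neq0$ there exist $\ell,u$ with $\mathrm{acc}_M(x)=\{w\in\{0,1\}^{p(|x|)}: h_x(\ell)\le_{\rm lex}h_x(w)\le_{\rm lex}h_x(u)\}$; $f(x)=\#\mathrm{acc}_M(x)$.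 ${\rm CLU\#P_{free}}$: defined like ${\rm CLU\#P}$ but with no functions $b,t$ and no conditions on them. -}

module Defs where

open import Data.Bool using (Bool; true; false; _<_)
open import Data.Nat using (ℕ; zero; suc; _+_; _*_)
open import Data.Fin using (Fin)
import Data.Fin
open import Data.List using (List; []; _∷_; _++_; length; map; filterᵇ)
open import Data.Vec using (Vec; []; _∷_; toList; replicate)
open import Data.Product using (Σ; _×_; _,_; proj₁)
open import Data.Sum using (_⊎_)
open import Data.Empty using (⊥)
open import Relation.Nullary using (¬_)
open import Relation.Binary.PropositionalEquality using (_≡_; _≢_)
open import Function.Bundles using (_↔_; Inverse; _⇔_)

-- Strings over Σ = {0,1}  (false = 0, true = 1)

Str : Set
Str = List Bool

-- Polynomials with natural coefficients (constant term first)

Poly : Set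
Poly = List ℕ

evalP : Poly → ℕ → ℕ
evalP []       n = 0
evalP (c ∷ cs) n = c + n * evalP cs n

-- Deterministic single-tape Turing machines (two-way infinite tape).
-- States: Fin (suc nQ).  Tape alphabet: Fin (3 + nΓ) where
-- 0 = blank, 1 = bit 0, 2 = bit 1, the rest are work symbols.

data Move : Set where
  L R S : Move

Γ : ℕ → Set
Γ g = Fin (suc (suc (suc g)))

record TM : Set where
  field
    nQ        : ℕ
    nΓ        : ℕ
    start     : Fin (suc nQ)
    halting   : Fin (suc nQ) → Bool
    accepting : Fin (suc nQ) → Bool
    δ         : Fin (suc nQ) → Γ nΓ → Fin (suc nQ) × Γ nΓ × Move

record Config (M : TM) : Set where
  constructor cfg
  field
    state : Fin (suc (TM.nQ M))
    left  : List (Γ (TM.nΓ M))   -- cells left of the head, nearest first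
    head  : Γ (TM.nΓ M)
    right : List (Γ (TM.nΓ M))   -- cells right of the head, nearest first

module _ {g : ℕ} where
  blank : Γ g
  blank = Data.Fin.zero

  encBit : Bool → Γ g
  encBit false = Data.Fin.suc Data.Fin.zero
  encBit true  = Data.Fin.suc (Data.Fin.suc Data.Fin.zero)

  readBits : List (Γ g) → Str
  readBits [] = []
  readBits (Data.Fin.suc Data.Fin.zero ∷ cs) = false ∷ readBits cs
  readBits (Data.Fin.suc (Data.Fin.suc Data.Fin.zero) ∷ cs) = true ∷ readBits cs
  readBits (_ ∷ cs) = []

initConfig : (M : TM) → Str → Config M
initConfig M []      = cfg (TM.start M) [] blank []
initConfig M (b ∷ x) = cfg (TM.start M) [] (encBit b) (map encBit x)

step : (M : TM) → Config M → Config M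
step M c@(cfg q l h r) with TM.halting M q
... | true  = c
... | false with TM.δ M q h
...   | (q' , a , S) = cfg q' l a r
...   | (q' , a , R) with r
...     | []      = cfg q' (a ∷ l) blank []
...     | (h' ∷ r') = cfg q' (a ∷ l) h' r'
step M c@(cfg q l h r) | false | (q' , a , L) with l
...     | []      = cfg q' [] blank (a ∷ r)
...     | (h' ∷ l') = cfg q' l' h' (a ∷ r)

run : (M : TM) → ℕ → Config M → Config M
run M zero    c = c
run M (suc t) c = run M t (step M c)

Halted : (M : TM) → Config M → Set
Halted M c = TM.halting M (Config.state c) ≡ true

output : (M : TM) → Config M → Str
output M c = readBits (Config.head c ∷ Config.right c)

runP : (M : TM) → Poly → Str → Config M
runP M q x = run M (evalP q (length x)) (initConfig M x)

FPt : (Str → Str) → Set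
FPt f = Σ TM λ M → Σ Poly λ q → ∀ x →
  Halted M (runP M q x) × output M (runP M q x) ≡ f x

PolyTimeDec : (Str → Bool) → Set
PolyTimeDec P = Σ TM λ M → Σ Poly λ q → ∀ x →
  Halted M (runP M q x) × TM.accepting M (Config.state (runP M q x)) ≡ P x

double : Str → Str
double []      = []
double (b ∷ x) = b ∷ b ∷ double x

pair : Str → Str → Str
pair x y = double x ++ (false ∷ true ∷ y)

triple : Str → Str → Str → Str
triple x y z = pair x (pair y z)

LexLt : ∀ {n} → Vec Bool n → Vec Bool n → Set
LexLt []       []       = ⊥
LexLt (a ∷ as) (b ∷ bs) = a < b ⊎ (a ≡ b × LexLt as bs)

LexLeq : ∀ {n} → Vec Bool n → Vec Bool n → Set
LexLeq a b = a ≡ b ⊎ LexLt a b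

LexSucc : ∀ {n} → Vec Bool n → Vec Bool n → Set
LexSucc a b = LexLt a b × (∀ c → ¬ (LexLt a c × LexLt c b))

allStrs : (m : ℕ) → List (Vec Bool m)
allStrs zero    = [] ∷ []
allStrs (suc m) = map (false ∷_) (allStrs m) ++ map (true ∷_) (allStrs m)

-- A p-balanced NPTM is given by p and a polynomial-time predicate V:
-- the path with guess string w (|w| = p(|x|)) accepts iff V ⟨x,w⟩ = true.
Accepts : (Str → Bool) → Str → ∀ {m} → Vec Bool m → Set
Accepts V x w = V (pair x (toList w)) ≡ true

numAcc : (Str → Bool) → Str → (m : ℕ) → ℕ
numAcc V x m = length (filterᵇ (λ w → V (pair x (toList w))) (allStrs m))

module _ (V : Str → Bool) (prec : Str → Bool) (f : Str → ℕ) (x : Str) {m : ℕ}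
         (h : Vec Bool m ↔ Vec Bool m) where
  private
    H = Inverse.to h

  Adjacency : Set
  Adjacency = ∀ (y z : Vec Bool m) →
    (prec (triple x (toList y) (toList z)) ≡ true) ⇔ LexSucc (H y) (H z)

  Cluster : Set
  Cluster = f x ≢ 0 → Σ (Vec Bool m) λ ℓ → Σ (Vec Bool m) λ u →
    ∀ (w : Vec Bool m) → Accepts V x w ⇔ (LexLeq (H ℓ) (H w) × LexLeq (H w) (H u))

  Counts : Set
  Counts = f x ≡ numAcc V x m

CLUSharpP : (Str → ℕ) → Set
CLUSharpP f =
  Σ Poly λ p → Σ (Str → Bool) λ V → PolyTimeDec V ×
  Σ (Str → Str) λ b → FPt b × Σ (Str → Str) λ t → FPt t ×
  Σ (Str → Bool) λ prec → PolyTimeDec prec ×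
  (∀ x → let m = evalP p (length x) in
     Σ (Vec Bool m ↔ Vec Bool m) λ h →
       (Σ (Vec Bool m) λ bv → toList bv ≡ b x × Inverse.to h bv ≡ replicate m false) ×
       (Σ (Vec Bool m) λ tv → toList tv ≡ t x × Inverse.to h tv ≡ replicate m true) ×
       Adjacency V prec f x h × Cluster V prec f x h × Counts V prec f x h)

CLUSharpPfree : (Str → ℕ) → Set
CLUSharpPfree f =
  Σ Poly λ p → Σ (Str → Bool) λ V → PolyTimeDec V ×
  Σ (Str → Bool) λ prec → PolyTimeDec prec ×
  (∀ x → let m = evalP p (length x) in
     Σ (Vec Bool m ↔ Vec Bool m) λ h →
       Adjacency V prec f x h × Cluster V prec f x h × Counts V prec f x h)

ZeroOneF : (Str → ℕ) → Set
ZeroOneF f = ∀ x → f x ≡ 0 ⊎ f x ≡ 1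

-- For a 0-1 valued f the accepting paths form either the empty set or a single
-- path, which is an interval of every linear order.  So one may keep the verifier
-- and its polynomial p and take h to be the identity: then b(x) = 0^p(|x|),
-- t(x) = 1^p(|x|), and the adjacency predicate says that in ⟨x,⟨y,z⟩⟩ the string z
-- is the lexicographic successor of y.  What remains is that these three functions
-- are computed by polynomial-time Turing machines: one writes v^p(n) by Horner's
-- rule, the other parses ⟨x,⟨y,z⟩⟩ and compares y with z bit by bit, zig-zagging
-- between them.

{-# OPTIONS --safe #-}
module Submission where

open import Defs hiding (step; run; Halted)
open import Data.Bool using (Bool; true; false; T; f<t; if_then_else_)
open import Data.Bool.Properties using (T?; T-≡) renaming (<-asym to <ᵇ-asym)
open import Data.Empty using (⊥-elim)
open import Data.Fin using (Fin; fromℕ<; toℕ)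
open import Data.Fin.Properties using (1↔⊤; 2↔Bool; +↔⊎; *↔×; toℕ-fromℕ<; toℕ<n)
open import Data.List using (List; []; _∷_; _++_; length; map; _ʳ++_; drop; filterᵇ)
import Data.List as List
open import Data.List.Membership.Propositional using (_∈_)
open import Data.List.Membership.Propositional.Properties using (∈-++⁺ˡ; ∈-++⁺ʳ; ∈-map⁺; ∈-filter⁺; ∈-filter⁻)
open import Data.List.Properties using (++-assoc; ++-identityʳ; ++-ʳ++; length-++; length-map; length-replicate; map-++; map-id)
open import Data.List.Relation.Unary.All using (All; []; _∷_)
import Data.List.Relation.Unary.All as All
open import Data.List.Relation.Unary.All.Properties using (++⁺; map⁺)
open import Data.List.Relation.Unary.Any using (here)
open import Data.Maybe using (Maybe; just; nothing; maybe)
import Data.Maybe as Maybe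
open import Data.Nat using (ℕ; zero; suc; _+_; _*_; _^_; _∸_; _≤_; _<_; z≤n; s≤s; s≤s⁻¹)
open import Data.Nat.ListAction using (sum)
open import Data.Nat.Properties
open import Data.Nat.Tactic.RingSolver using (solve-∀)
open import Data.Product using (Σ; _×_; _,_; proj₁; proj₂; map₁)
open import Data.Product.Function.NonDependent.Propositional using (_×-↪_)
open import Data.Sum using (_⊎_; inj₁; inj₂)
open import Data.Sum.Function.Propositional using (_⊎-↪_)
open import Data.Unit using (⊤; tt)
open import Data.Vec using (Vec; []; _∷_; toList; replicate)
import Data.Vec as Vec
open import Data.Vec.Properties using (toList-replicate)
open import Function using (_∘_; id)
open import Function.Bundles using (_⇔_; mk⇔; Equivalence; _↪_; mk↪; RightInverse)
open import Function.Construct.Composition using (_↪-∘_)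
open import Function.Construct.Identity using (↔-id)
open import Function.Construct.Symmetry using (↔-sym)
open import Function.Properties.Inverse using (↔⇒↪)
open import Relation.Binary.PropositionalEquality
open import Relation.Nullary using (¬_; contradiction; recompute)

-- Lexicographic successor

LexLt-asym : ∀ {n} (y z : Vec Bool n) → LexLt y z → ¬ LexLt z y
LexLt-asym [] [] ()
LexLt-asym (a ∷ y) (b ∷ z) (inj₁ a<b) (inj₁ b<a) = <ᵇ-asym a<b b<a
LexLt-asym (a ∷ y) (.a ∷ z) (inj₁ a<a) (inj₂ (refl , _)) = <ᵇ-asym a<a a<a
LexLt-asym (a ∷ y) (.a ∷ z) (inj₂ (refl , _)) (inj₁ a<a) = <ᵇ-asym a<a a<a
LexLt-asym (a ∷ y) (.a ∷ z) (inj₂ (refl , y<z)) (inj₂ (_ , z<y)) = LexLt-asym y z y<z z<y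

LexLeq-antisym : ∀ {n} {y z : Vec Bool n} → LexLeq y z → LexLeq z y → y ≡ z
LexLeq-antisym (inj₁ y≡z) _ = y≡z
LexLeq-antisym (inj₂ _) (inj₁ refl) = refl
LexLeq-antisym {y = y} {z} (inj₂ y<z) (inj₂ z<y) = ⊥-elim (LexLt-asym y z y<z z<y)

ones-maximal : ∀ {n} (y : Vec Bool n) → ¬ LexLt (replicate n true) y
ones-maximal (_ ∷ y) (inj₂ (_ , lt)) = ones-maximal y lt

zeros-minimal : ∀ {n} (y : Vec Bool n) → ¬ LexLt y (replicate n false)
zeros-minimal (_ ∷ y) (inj₂ (_ , lt)) = zeros-minimal y lt

ones-or-below : ∀ {n} (y : Vec Bool n) → y ≡ replicate n true ⊎ LexLt y (replicate n true)
ones-or-below [] = inj₁ refl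
ones-or-below (false ∷ y) = inj₂ (inj₁ f<t)
ones-or-below (true ∷ y) with ones-or-below y
... | inj₁ refl = inj₁ refl
... | inj₂ lt = inj₂ (inj₂ (refl , lt))

zeros-or-above : ∀ {n} (y : Vec Bool n) → y ≡ replicate n false ⊎ LexLt (replicate n false) y
zeros-or-above [] = inj₁ refl
zeros-or-above (true ∷ y) = inj₂ (inj₁ f<t)
zeros-or-above (false ∷ y) with zeros-or-above y
... | inj₁ refl = inj₁ refl
... | inj₂ lt = inj₂ (inj₂ (refl , lt))

LexSucc-∷ : ∀ {n} a {y z : Vec Bool n} → LexSucc y z → LexSucc (a ∷ y) (a ∷ z)
LexSucc-∷ a (y<z , adjacent) = inj₂ (refl , y<z) , λ where
  (c ∷ w) (inj₂ (refl , y<w) , inj₂ (_ , w<z)) → adjacent w (y<w , w<z)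
  (c ∷ w) (inj₁ a<c , inj₁ c<a) → <ᵇ-asym a<c c<a
  (c ∷ w) (inj₁ a<a , inj₂ (refl , _)) → <ᵇ-asym a<a a<a
  (c ∷ w) (inj₂ (refl , _) , inj₁ a<a) → <ᵇ-asym a<a a<a

LexSucc-carry : ∀ {n} → LexSucc (false ∷ replicate n true) (true ∷ replicate n false)
LexSucc-carry {n} = inj₁ f<t , λ where
  (false ∷ w) (inj₂ (_ , lt) , _) → ones-maximal w lt
  (true ∷ w) (_ , inj₂ (_ , lt)) → zeros-minimal w lt

LexSucc-∷⁻ : ∀ {n} {a} {y z : Vec Bool n} → LexSucc (a ∷ y) (a ∷ z) → LexSucc y z
LexSucc-∷⁻ (inj₂ (_ , y<z) , adjacent) = y<z , λ w (y<w , w<z) → adjacent (_ ∷ w) (inj₂ (refl , y<w) , inj₂ (refl , w<z))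
LexSucc-∷⁻ (inj₁ a<a , _) = ⊥-elim (<ᵇ-asym a<a a<a)

-- Read as a sequence of pairs (yᵢ, zᵢ), z is the lexicographic successor of y
-- exactly when the sequence lies in (00 ∣ 11)* 01 (10)*.
data Phase : Set where
  equal flipped : Phase

compareStep : Phase → Bool → Bool → Maybe Phase
compareStep equal false false = just equal
compareStep equal true true = just equal
compareStep equal false true = just flipped
compareStep flipped true false = just flipped
compareStep _ _ _ = nothing

isFlipped : Phase → Bool
isFlipped equal = false
isFlipped flipped = true

runCompare : Phase → List Bool → List Bool → Bool
runCompare s [] [] = isFlipped s
runCompare s (b ∷ y) (c ∷ z) = maybe (λ s′ → runCompare s′ y z) false (compareStep s b c)
runCompare s _ _ = false

isLexSucc : List Bool → List Bool → Bool
isLexSucc = runCompare equal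

runCompare-flipped-sound : ∀ {n} (y z : Vec Bool n) → runCompare flipped (toList y) (toList z) ≡ true →
  y ≡ replicate n true × z ≡ replicate n false
runCompare-flipped-sound [] [] _ = refl , refl
runCompare-flipped-sound (true ∷ y) (false ∷ z) accept with runCompare-flipped-sound y z accept
... | refl , refl = refl , refl

runCompare-flipped-complete : ∀ n → runCompare flipped (toList (replicate n true)) (toList (replicate n false)) ≡ true
runCompare-flipped-complete zero = refl
runCompare-flipped-complete (suc n) = runCompare-flipped-complete n

isLexSucc-sound : ∀ {n} (y z : Vec Bool n) → isLexSucc (toList y) (toList z) ≡ true → LexSucc y z
isLexSucc-sound [] [] ()
isLexSucc-sound (false ∷ y) (false ∷ z) accept = LexSucc-∷ false (isLexSucc-sound y z accept)
isLexSucc-sound (true ∷ y) (true ∷ z) accept = LexSucc-∷ true (isLexSucc-sound y z accept)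
isLexSucc-sound (false ∷ y) (true ∷ z) accept with runCompare-flipped-sound y z accept
... | refl , refl = LexSucc-carry

isLexSucc-complete : ∀ {n} (y z : Vec Bool n) → LexSucc y z → isLexSucc (toList y) (toList z) ≡ true
isLexSucc-complete [] [] (() , _)
isLexSucc-complete (false ∷ y) (false ∷ z) succ = isLexSucc-complete y z (LexSucc-∷⁻ succ)
isLexSucc-complete (true ∷ y) (true ∷ z) succ = isLexSucc-complete y z (LexSucc-∷⁻ succ)
isLexSucc-complete (true ∷ y) (false ∷ z) (inj₁ () , _)
isLexSucc-complete (true ∷ y) (false ∷ z) (inj₂ (() , _) , _)
isLexSucc-complete {suc n} (false ∷ y) (true ∷ z) (_ , adjacent)
  with ones-or-below y | zeros-or-above z
... | inj₁ refl | inj₁ refl = runCompare-flipped-complete n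
... | inj₂ y<ones | _ = ⊥-elim (adjacent (false ∷ replicate n true) (inj₂ (refl , y<ones) , inj₁ f<t))
... | inj₁ _ | inj₂ zeros<z = ⊥-elim (adjacent (true ∷ replicate n false) (inj₁ f<t , inj₂ (refl , zeros<z)))

isLexSucc⇔LexSucc : ∀ {n} (y z : Vec Bool n) → (isLexSucc (toList y) (toList z) ≡ true) ⇔ LexSucc y z
isLexSucc⇔LexSucc y z = mk⇔ (isLexSucc-sound y z) (isLexSucc-complete y z)

-- A single accepting path

∈-allStrs : ∀ {m} (w : Vec Bool m) → w ∈ allStrs m
∈-allStrs [] = here refl
∈-allStrs {suc m} (false ∷ w) = ∈-++⁺ˡ (∈-map⁺ (false ∷_) (∈-allStrs w))
∈-allStrs {suc m} (true ∷ w) = ∈-++⁺ʳ (map (false ∷_) (allStrs m)) (∈-map⁺ (true ∷_) (∈-allStrs w))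

unique-accepting-path : ∀ (V : Str → Bool) x m → numAcc V x m ≡ 1 →
  Σ (Vec Bool m) λ w₀ → ∀ (w : Vec Bool m) → Accepts V x w ⇔ (LexLeq w₀ w × LexLeq w w₀)
unique-accepting-path V x m one with filterᵇ (λ w → V (pair x (toList w))) (allStrs m) in paths
... | w₀ ∷ [] = w₀ , λ w → mk⇔ (only-w₀ w) (λ (w₀≤w , w≤w₀) → subst (Accepts V x) (LexLeq-antisym w₀≤w w≤w₀) w₀-accepts)
  where
  acceptsᵇ = λ (w : Vec Bool m) → V (pair x (toList w))
  only-w₀ : ∀ w → Accepts V x w → LexLeq w₀ w × LexLeq w w₀
  only-w₀ w acc with subst (w ∈_) paths (∈-filter⁺ (T? ∘ acceptsᵇ) (∈-allStrs w) (Equivalence.from T-≡ acc))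
  ... | here refl = inj₁ refl , inj₁ refl
  w₀-accepts : Accepts V x w₀
  w₀-accepts = Equivalence.to T-≡ (proj₂ (∈-filter⁻ (T? ∘ acceptsᵇ) {xs = allStrs m} (subst (w₀ ∈_) (sym paths) (here refl))))

-- The adjacency predicate

unpair : Str → Maybe (Str × Str)
unpair (false ∷ false ∷ s) = Maybe.map (map₁ (false ∷_)) (unpair s)
unpair (true ∷ true ∷ s) = Maybe.map (map₁ (true ∷_)) (unpair s)
unpair (false ∷ true ∷ s) = just ([] , s)
unpair _ = nothing

unpair-pair : ∀ u r → unpair (pair u r) ≡ just (u , r)
unpair-pair [] r = refl
unpair-pair (false ∷ u) r rewrite unpair-pair u r = refl
unpair-pair (true ∷ u) r rewrite unpair-pair u r = refl

unpair-sound : ∀ s {u r} → unpair s ≡ just (u , r) → s ≡ pair u r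
unpair-sound (false ∷ true ∷ s) refl = refl
unpair-sound (false ∷ false ∷ s) eq with unpair s in eq′
unpair-sound (false ∷ false ∷ s) refl | just (u , r) = cong (λ s → false ∷ false ∷ s) (unpair-sound s eq′)
unpair-sound (true ∷ true ∷ s) eq with unpair s in eq′
unpair-sound (true ∷ true ∷ s) refl | just (u , r) = cong (λ s → true ∷ true ∷ s) (unpair-sound s eq′)

lexPrec : Str → Bool
lexPrec s = maybe (λ (x , r) → maybe (λ (y , z) → isLexSucc y z) false (unpair r)) false (unpair s)

lexPrec-triple : ∀ x y z → lexPrec (triple x y z) ≡ isLexSucc y z
lexPrec-triple x y z rewrite unpair-pair x (pair y z) | unpair-pair y z = refl

-- Finite encodings

⊤-code : ⊤ ↪ Fin 1
⊤-code = ↔⇒↪ (↔-sym 1↔⊤)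

Bool-code : Bool ↪ Fin 2
Bool-code = ↔⇒↪ (↔-sym 2↔Bool)

⊎-code : ∀ {A B : Set} {m n} → A ↪ Fin m → B ↪ Fin n → (A ⊎ B) ↪ Fin (m + n)
⊎-code a b = ↔⇒↪ (↔-sym +↔⊎) ↪-∘ (a ⊎-↪ b)

×-code : ∀ {A B : Set} {m n} → A ↪ Fin m → B ↪ Fin n → (A × B) ↪ Fin (m * n)
×-code a b = ↔⇒↪ (↔-sym *↔×) ↪-∘ (a ×-↪ b)

retract-code : ∀ {A B : Set} {n} (f : A → B) (g : B → A) → (∀ a → g (f a) ≡ a) → B ↪ Fin n → A ↪ Fin n
retract-code f g g∘f code = code ↪-∘ mk↪ {to = f} {from = g} λ { refl → g∘f _ }

Vec-code : ∀ n → Vec Bool n ↪ Fin (2 ^ n)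
Vec-code zero = retract-code _ (λ _ → []) (λ { [] → refl }) ⊤-code
Vec-code (suc n) = retract-code (λ { (b ∷ v) → b , v }) (λ (b , v) → b ∷ v) (λ { (b ∷ v) → refl }) (×-code Bool-code (Vec-code n))

record Below (n : ℕ) : Set where
  constructor below
  field
    value : ℕ
    .bound : value < n

Below-code : ∀ n → Below n ↪ Fin n
Below-code n = mk↪ {to = λ (below i i<n) → fromℕ< i<n} {from = λ i → below (toℕ i) (toℕ<n i)}
  λ { {below i i<n} refl → below-≡ (toℕ-fromℕ< i<n) }
  where
  below-≡ : ∀ {i j} .{i<n : i < n} .{j<n : j < n} → i ≡ j → below i i<n ≡ below j j<n
  below-≡ refl = refl

-- Turing machines over structured states and symbols

data Symbol (W : Set) : Set where
  ␣ : Symbol W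
  bit : Bool → Symbol W
  work : W → Symbol W

record Machine : Set₁ where
  field
    State : Set
    Work : Set
    start : State
    halts : State → Bool
    accepts : State → Bool
    δ : State → Symbol Work → State × Symbol Work × Move

module Run (M : Machine) where
  open Machine M

  Tape : Set
  Tape = List (Symbol Work)

  -- The head reads the first cell of the right part; an exhausted part reads as blank.
  record Cfg : Set where
    constructor conf
    field
      state : State
      left : Tape
      right : Tape
  open Cfg public

  hd : Tape → Symbol Work
  hd [] = ␣
  hd (a ∷ _) = a

  tl : Tape → Tape
  tl [] = []
  tl (_ ∷ r) = r

  move : Move → State → Symbol Work → Tape → Tape → Cfg
  move L q a l r = conf q (tl l) (hd l ∷ a ∷ r)
  move R q a l r = conf q (a ∷ l) r
  move S q a l r = conf q l (a ∷ r)

  perform : State × Symbol Work × Move → Tape → Tape → Cfg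
  perform (q , a , m) = move m q a

  step : Cfg → Cfg
  step c@(conf q l r) = if halts q then c else perform (δ q (hd r)) l (tl r)

  step-by : ∀ {q l r q′ a m} → halts q ≡ false → δ q (hd r) ≡ (q′ , a , m) → step (conf q l r) ≡ move m q′ a l (tl r)
  step-by running rule rewrite running | rule = refl

  run : ℕ → Cfg → Cfg
  run zero c = c
  run (suc t) c = run t (step c)

  initial : Str → Cfg
  initial x = conf start [] (map bit x)

  bits : Tape → Str
  bits (bit b ∷ r) = b ∷ bits r
  bits _ = []

  Halted : Cfg → Set
  Halted c = halts (state c) ≡ true

  run-+ : ∀ s t c → run (s + t) c ≡ run t (run s c)
  run-+ zero t c = refl
  run-+ (suc s) t c = run-+ s t (step c)

  run-halted : ∀ t c → Halted c → run t c ≡ c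
  run-halted zero c _ = refl
  run-halted (suc t) c@(conf q l r) halted rewrite halted = run-halted t c halted

  Reaches : ℕ → Cfg → Cfg → Set
  Reaches B c c′ = Σ ℕ λ t → t ≤ B × run t c ≡ c′

  reaches-mono : ∀ {B B′ c c′} → B ≤ B′ → Reaches B c c′ → Reaches B′ c c′
  reaches-mono B≤B′ (t , t≤B , ran) = t , ≤-trans t≤B B≤B′ , ran

  infixr 5 _⟫_
  _⟫_ : ∀ {s t c c′ c″} → Reaches s c c′ → Reaches t c′ c″ → Reaches (s + t) c c″
  _⟫_ {c = c} (s , s≤ , ran₁) (t , t≤ , ran₂) = s + t , +-mono-≤ s≤ t≤ , trans (run-+ s t c) (trans (cong (run t) ran₁) ran₂)

  reaches-≡ : ∀ {s t c c′} → s ≡ t → Reaches s c c′ → Reaches t c c′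
  reaches-≡ refl r = r

  reaches-subst : ∀ {t c₁ c₁′ c₂ c₂′} → c₁ ≡ c₁′ → c₂ ≡ c₂′ → Reaches t c₁ c₂ → Reaches t c₁′ c₂′
  reaches-subst refl refl r = r

  reaches-refl : ∀ {c} → Reaches 0 c c
  reaches-refl = 0 , ≤-refl , refl

  one-step : ∀ {c c′} → step c ≡ c′ → Reaches 1 c c′
  one-step stepped = 1 , ≤-refl , stepped

  reaches-halted : ∀ {B c c′} T → B ≤ T → Halted c′ → Reaches B c c′ → run T c ≡ c′
  reaches-halted {c = c} {c′} T B≤T halted (t , t≤B , ran) = begin
    run T c                 ≡⟨ cong (λ s → run s c) (sym (m+[n∸m]≡n t≤T)) ⟩
    run (t + (T ∸ t)) c     ≡⟨ run-+ t (T ∸ t) c ⟩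
    run (T ∸ t) (run t c)   ≡⟨ cong (run (T ∸ t)) ran ⟩
    run (T ∸ t) c′          ≡⟨ run-halted (T ∸ t) c′ halted ⟩
    c′                      ∎
    where
    open ≡-Reasoning
    t≤T = ≤-trans t≤B B≤T

  HaltsWithin : ℕ → Cfg → (Cfg → Set) → Set
  HaltsWithin B c P = Σ Cfg λ c′ → Reaches B c c′ × Halted c′ × P c′

  halts-after : ∀ {s t c c′ P} → Reaches s c c′ → HaltsWithin t c′ P → HaltsWithin (s + t) c P
  halts-after r (c″ , r′ , halted , answer) = c″ , (r ⟫ r′) , halted , answer

  halts-mono : ∀ {B B′ c P} → B ≤ B′ → HaltsWithin B c P → HaltsWithin B′ c P
  halts-mono B≤B′ (c′ , reach , halted , answer) = c′ , reaches-mono B≤B′ reach , halted , answer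

  halts-now : ∀ {c P} → Halted c → P c → HaltsWithin 0 c P
  halts-now {c} halted answer = c , reaches-refl , halted , answer

  module _ {q : State} (running : halts q ≡ false) (ok : Symbol Work → Set) where

    scanRight : (∀ {a} → ok a → δ q a ≡ (q , a , R)) →
      ∀ {seg} → All ok seg → ∀ l r → Reaches (length seg) (conf q l (seg ++ r)) (conf q (seg ʳ++ l) r)
    scanRight rule [] l r = reaches-refl
    scanRight rule {a ∷ _} (oka ∷ oks) l r = one-step (step-by running (rule oka)) ⟫ scanRight rule oks (a ∷ l) r

    rewriteLeft : (g : Symbol Work → Symbol Work) → (∀ {a} → ok a → δ q a ≡ (q , g a , L)) →
      ∀ {seg} → All ok seg → ∀ {q₀ a₀} l r → halts q₀ ≡ false → δ q₀ (hd r) ≡ (q , a₀ , L) →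
      Reaches (suc (length seg)) (conf q₀ (seg ʳ++ l) r) (conf q (tl l) (hd l ∷ map g seg ++ a₀ ∷ tl r))
    rewriteLeft g rule [] l r running₀ turn = one-step (step-by running₀ turn)
    rewriteLeft g rule {a ∷ seg} (oka ∷ oks) l r running₀ turn =
      reaches-≡ (+-comm (suc (length seg)) 1)
        (rewriteLeft g rule oks (a ∷ l) r running₀ turn ⟫ one-step (step-by running (rule oka)))

    scanLeft : (∀ {a} → ok a → δ q a ≡ (q , a , L)) →
      ∀ {seg} → All ok seg → ∀ {q₀ a₀} l r → halts q₀ ≡ false → δ q₀ (hd r) ≡ (q , a₀ , L) →
      Reaches (suc (length seg)) (conf q₀ (seg ʳ++ l) r) (conf q (tl l) (hd l ∷ seg ++ a₀ ∷ tl r))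
    scanLeft rule {seg} oks {a₀ = a₀} l r running₀ turn =
      reaches-subst refl (cong (λ s → conf q (tl l) (hd l ∷ s ++ a₀ ∷ tl r)) (map-id seg))
        (rewriteLeft id rule oks l r running₀ turn)

module _ (T : TM) where
  open TM T

  tmMove : Move → Fin (suc nQ) → Γ nΓ → List (Γ nΓ) → List (Γ nΓ) → Config T
  tmMove L q a [] r = cfg q [] blank (a ∷ r)
  tmMove L q a (h ∷ l) r = cfg q l h (a ∷ r)
  tmMove R q a l [] = cfg q (a ∷ l) blank []
  tmMove R q a l (h ∷ r) = cfg q (a ∷ l) h r
  tmMove S q a l r = cfg q l a r

  tm-step-halted : ∀ {q l h r} → halting q ≡ true → Defs.step T (cfg q l h r) ≡ cfg q l h r
  tm-step-halted {q} halted with halting q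
  ... | true = refl

  tm-step-running : ∀ {q l h r q′ a m} → halting q ≡ false → δ q h ≡ (q′ , a , m) →
    Defs.step T (cfg q l h r) ≡ tmMove m q′ a l r
  tm-step-running {q} {l} {h} {r} running rule with halting q
  ... | false with δ q h
  tm-step-running {l = l} {r = r} running refl | false | (q′ , a , L) with l
  ... | [] = refl
  ... | _ ∷ _ = refl
  tm-step-running {l = l} {r = r} running refl | false | (q′ , a , R) with r
  ... | [] = refl
  ... | _ ∷ _ = refl
  tm-step-running running refl | false | (q′ , a , S) = refl

module Compile (M : Machine) {nQ nΓ : ℕ} (encQ : Machine.State M ↪ Fin (suc nQ)) (encW : Machine.Work M ↪ Fin nΓ) where
  open Machine M
  open Run M
  open RightInverse encQ using () renaming (to to encState; from to decState; strictlyInverseʳ to decState-encState)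
  open RightInverse encW using () renaming (to to encWork; from to decWork; strictlyInverseʳ to decWork-encWork)

  encSym : Symbol Work → Γ nΓ
  encSym ␣ = Fin.zero
  encSym (bit false) = Fin.suc Fin.zero
  encSym (bit true) = Fin.suc (Fin.suc Fin.zero)
  encSym (work w) = Fin.suc (Fin.suc (Fin.suc (encWork w)))

  decSym : Γ nΓ → Symbol Work
  decSym Fin.zero = ␣
  decSym (Fin.suc Fin.zero) = bit false
  decSym (Fin.suc (Fin.suc Fin.zero)) = bit true
  decSym (Fin.suc (Fin.suc (Fin.suc i))) = work (decWork i)

  decSym-encSym : ∀ a → decSym (encSym a) ≡ a
  decSym-encSym ␣ = refl
  decSym-encSym (bit false) = refl
  decSym-encSym (bit true) = refl
  decSym-encSym (work w) = cong work (decWork-encWork w)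

  encAction : State × Symbol Work × Move → Fin (suc nQ) × Γ nΓ × Move
  encAction (q , a , m) = encState q , encSym a , m

  tm : TM
  tm = record
    { nQ = nQ ; nΓ = nΓ ; start = encState start
    ; halting = λ i → halts (decState i)
    ; accepting = λ i → accepts (decState i)
    ; δ = λ i a → encAction (δ (decState i) (decSym a)) }

  encCfg : Cfg → Config tm
  encCfg (conf q l r) = cfg (encState q) (map encSym l) (encSym (hd r)) (map encSym (tl r))

  move-encode : ∀ m q a l r → encCfg (move m q a l r) ≡ tmMove tm m (encState q) (encSym a) (map encSym l) (map encSym r)
  move-encode L q a [] r = refl
  move-encode L q a (_ ∷ _) r = refl
  move-encode R q a l [] = refl
  move-encode R q a l (_ ∷ _) = refl
  move-encode S q a l r = refl

  step-encode : ∀ c → Defs.step tm (encCfg c) ≡ encCfg (step c)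
  step-encode (conf q l r) with halts q in halting
  ... | true = tm-step-halted tm (trans (cong halts (decState-encState q)) halting)
  ... | false with δ q (hd r) in rule
  ... | (q′ , a , m) = trans
    (tm-step-running tm (trans (cong halts (decState-encState q)) halting)
      (cong encAction (trans (cong₂ δ (decState-encState q) (decSym-encSym (hd r))) rule)))
    (sym (move-encode m q′ a l (tl r)))

  run-encode : ∀ t c → Defs.run tm t (encCfg c) ≡ encCfg (run t c)
  run-encode zero c = refl
  run-encode (suc t) c = trans (cong (Defs.run tm t) (step-encode c)) (run-encode t (step c))

  initial-encode : ∀ x → initConfig tm x ≡ encCfg (initial x)
  initial-encode [] = refl
  initial-encode (b ∷ x) = cong₂ (cfg (encState start) []) (encBit-bit b) (map-encBit x)
    where
    encBit-bit : ∀ b → encBit b ≡ encSym (bit b)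
    encBit-bit false = refl
    encBit-bit true = refl
    map-encBit : ∀ x → map encBit x ≡ map encSym (map bit x)
    map-encBit [] = refl
    map-encBit (b ∷ x) = cong₂ _∷_ (encBit-bit b) (map-encBit x)

  output-encode : ∀ c → output tm (encCfg c) ≡ bits (right c)
  output-encode (conf q l r) = trans (readBits-encode (hd r ∷ tl r)) (hd∷tl r)
    where
    readBits-encode : ∀ r → readBits (map encSym r) ≡ bits r
    readBits-encode [] = refl
    readBits-encode (␣ ∷ r) = refl
    readBits-encode (bit false ∷ r) = cong (false ∷_) (readBits-encode r)
    readBits-encode (bit true ∷ r) = cong (true ∷_) (readBits-encode r)
    readBits-encode (work w ∷ r) = refl
    hd∷tl : ∀ r → bits (hd r ∷ tl r) ≡ bits r
    hd∷tl [] = refl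
    hd∷tl (_ ∷ _) = refl

  runP-encode : ∀ q x → runP tm q x ≡ encCfg (run (evalP q (length x)) (initial x))
  runP-encode q x = trans (cong (Defs.run tm (evalP q (length x))) (initial-encode x)) (run-encode (evalP q (length x)) (initial x))

  computes : (f : Str → Str) (q : Poly) → (∀ x → HaltsWithin (evalP q (length x)) (initial x) (λ c → bits (right c) ≡ f x)) → FPt f
  computes f q halts-with = tm , q , λ x → let (c , reach , halted , out) = halts-with x in
    subst (λ c′ → Defs.Halted tm c′ × output tm c′ ≡ f x)
      (sym (trans (runP-encode q x) (cong encCfg (reaches-halted _ ≤-refl halted reach))))
      (trans (cong halts (decState-encState (state c))) halted , trans (output-encode c) out)

  decides : (P : Str → Bool) (q : Poly) → (∀ x → HaltsWithin (evalP q (length x)) (initial x) (λ c → accepts (state c) ≡ P x)) → PolyTimeDec P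
  decides P q halts-with = tm , q , λ x → let (c , reach , halted , answer) = halts-with x in
    subst (λ c′ → Defs.Halted tm c′ × TM.accepting tm (Config.state c′) ≡ P x)
      (sym (trans (runP-encode q x) (cong encCfg (reaches-halted _ ≤-refl halted reach))))
      (trans (cong halts (decState-encState (state c))) halted , trans (cong accepts (decState-encState (state c))) answer)

-- Polynomial time bounds

infixl 6 _⊕_
infixl 7 _⊗_

_⊕_ : Poly → Poly → Poly
[] ⊕ q = q
(a ∷ p) ⊕ [] = a ∷ p
(a ∷ p) ⊕ (b ∷ q) = a + b ∷ p ⊕ q

_⊗_ : Poly → Poly → Poly
[] ⊗ q = []
(a ∷ p) ⊗ q = map (a *_) q ⊕ (0 ∷ p ⊗ q)

evalP-⊕ : ∀ p q n → evalP (p ⊕ q) n ≡ evalP p n + evalP q n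
evalP-⊕ [] q n = refl
evalP-⊕ (a ∷ p) [] n = sym (+-identityʳ _)
evalP-⊕ (a ∷ p) (b ∷ q) n rewrite evalP-⊕ p q n = solve a b n (evalP p n) (evalP q n)
  where
  solve : ∀ a b n x y → a + b + n * (x + y) ≡ a + n * x + (b + n * y)
  solve = solve-∀

evalP-scale : ∀ a q n → evalP (map (a *_) q) n ≡ a * evalP q n
evalP-scale a [] n = sym (*-zeroʳ a)
evalP-scale a (b ∷ q) n rewrite evalP-scale a q n = solve a b n (evalP q n)
  where
  solve : ∀ a b n x → a * b + n * (a * x) ≡ a * (b + n * x)
  solve = solve-∀

evalP-⊗ : ∀ p q n → evalP (p ⊗ q) n ≡ evalP p n * evalP q n
evalP-⊗ [] q n = refl
evalP-⊗ (a ∷ p) q n rewrite evalP-⊕ (map (a *_) q) (0 ∷ p ⊗ q) n | evalP-scale a q n | evalP-⊗ p q n =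
  solve a n (evalP p n) (evalP q n)
  where
  solve : ∀ a n x y → a * y + n * (x * y) ≡ (a + n * x) * y
  solve = solve-∀

PolyBounded : (ℕ → ℕ) → Set
PolyBounded f = Σ Poly λ q → ∀ n → f n ≤ evalP q n

bounded-const : ∀ c → PolyBounded (λ _ → c)
bounded-const c = c ∷ [] , λ n → ≤-reflexive (sym (trans (cong (c +_) (*-zeroʳ n)) (+-identityʳ c)))

bounded-id : PolyBounded (λ n → n)
bounded-id = 0 ∷ 1 ∷ [] , λ n → ≤-reflexive (sym (solve n))
  where
  solve : ∀ n → 0 + n * (1 + n * 0) ≡ n
  solve = solve-∀

bounded-evalP : ∀ p → PolyBounded (evalP p)
bounded-evalP p = p , λ n → ≤-refl

bounded-+ : ∀ {f g} → PolyBounded f → PolyBounded g → PolyBounded (λ n → f n + g n)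
bounded-+ (p , f≤p) (q , g≤q) = p ⊕ q , λ n → subst (_ ≤_) (sym (evalP-⊕ p q n)) (+-mono-≤ (f≤p n) (g≤q n))

bounded-* : ∀ {f g} → PolyBounded f → PolyBounded g → PolyBounded (λ n → f n * g n)
bounded-* (p , f≤p) (q , g≤q) = p ⊗ q , λ n → subst (_ ≤_) (sym (evalP-⊗ p q n)) (*-mono-≤ (f≤p n) (g≤q n))

-- The lexicographic-successor machine

module LexSuccessorMachine where

  data Block : Set where
    xBlock yBlock : Block

  data Cell : Set where
    pad : Cell
    ycell zcell : Bool → Bool → Cell

  -- A first pass checks that the input has the shape ⟨x,⟨y,z⟩⟩ and rewrites it into
  -- pads for x and the separators and one cell per bit of y and of z, whose flag
  -- records whether the bit has been compared yet.  Then the machine zig-zags: it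
  -- carries the first uncompared bit of y to the first uncompared bit of z, feeds
  -- the pair to compareStep, and rewinds to the left end.
  data LexState : Set where
    first : Block → LexState
    second : Block → Bool → LexState
    zCopy : LexState
    rewind seekY : Phase → LexState
    seekZ : Phase → Bool → LexState
    accept reject : LexState

  Sym : Set
  Sym = Symbol Cell

  ▢ : Sym
  ▢ = work pad

  yc zc : Bool → Bool → Sym
  yc b m = work (ycell b m)
  zc c m = work (zcell c m)

  cellFor : Block → Bool → Sym
  cellFor xBlock b = ▢
  cellFor yBlock b = yc b false

  after : Block → LexState
  after xBlock = first yBlock
  after yBlock = zCopy

  verdict : Phase → LexState
  verdict equal = reject
  verdict flipped = accept

  δ : LexState → Sym → LexState × Sym × Move
  δ (first k) (bit b) = second k b , ▢ , R
  δ (second k false) (bit false) = first k , cellFor k false , R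
  δ (second k true) (bit true) = first k , cellFor k true , R
  δ (second k false) (bit true) = after k , ▢ , R
  δ zCopy (bit c) = zCopy , zc c false , R
  δ zCopy ␣ = rewind equal , ␣ , L
  δ (rewind s) (work w) = rewind s , work w , L
  δ (rewind s) ␣ = seekY s , ␣ , R
  δ (seekY s) (work pad) = seekY s , ▢ , R
  δ (seekY s) (work (ycell b true)) = seekY s , yc b true , R
  δ (seekY s) (work (zcell c true)) = seekY s , zc c true , R
  δ (seekY s) (work (ycell b false)) = seekZ s b , yc b true , R
  δ (seekY s) ␣ = verdict s , ␣ , S
  δ (seekZ s b) (work pad) = seekZ s b , ▢ , R
  δ (seekZ s b) (work (ycell b′ m)) = seekZ s b , yc b′ m , R
  δ (seekZ s b) (work (zcell c true)) = seekZ s b , zc c true , R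
  δ (seekZ s b) (work (zcell c false)) =
    maybe (λ s′ → rewind s′ , zc c true , L) (reject , zc c false , S) (compareStep s b c)
  δ q a = reject , a , S  -- in particular every input not of the form ⟨x,⟨y,z⟩⟩

  halts : LexState → Bool
  halts accept = true
  halts reject = true
  halts _ = false

  accepts : LexState → Bool
  accepts accept = true
  accepts _ = false

  lexMachine : Machine
  lexMachine = record
    { State = LexState ; Work = Cell ; start = first xBlock
    ; halts = halts ; accepts = accepts ; δ = δ }

  open Run lexMachine

  Rejects : ℕ → Cfg → Set
  Rejects B c = HaltsWithin B c (λ c′ → accepts (state c′) ≡ false)

  pairCells : Block → Str → Tape
  pairCells k [] = ▢ ∷ ▢ ∷ []
  pairCells k (b ∷ u) = ▢ ∷ cellFor k b ∷ pairCells k u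

  parse-pair : ∀ k u r l →
    Reaches (length (double u) + 2) (conf (first k) l (map bit (pair u r))) (conf (after k) (pairCells k u ʳ++ l) (map bit r))
  parse-pair k [] r l = one-step refl ⟫ one-step refl
  parse-pair k (b ∷ u) r l = two-steps b ⟫ parse-pair k u r (cellFor k b ∷ ▢ ∷ l)
    where
    two-steps : ∀ b → Reaches 2 (conf (first k) l (map bit (pair (b ∷ u) r))) (conf (first k) (cellFor k b ∷ ▢ ∷ l) (map bit (pair u r)))
    two-steps false = one-step refl ⟫ one-step refl
    two-steps true = one-step refl ⟫ one-step refl

  parse-pair-rejects : ∀ k s l → unpair s ≡ nothing → Rejects (suc (length s)) (conf (first k) l (map bit s))
  parse-pair-rejects k [] l _ = halts-after (one-step refl) (halts-now refl refl)
  parse-pair-rejects k (false ∷ []) l _ = halts-after (one-step refl ⟫ one-step refl) (halts-now refl refl)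
  parse-pair-rejects k (true ∷ []) l _ = halts-after (one-step refl ⟫ one-step refl) (halts-now refl refl)
  parse-pair-rejects k (true ∷ false ∷ s) l _ =
    halts-mono (s≤s (s≤s z≤n)) (halts-after (one-step refl ⟫ one-step refl) (halts-now refl refl))
  parse-pair-rejects k (false ∷ false ∷ s) l none with unpair s in eq
  ... | nothing = halts-after (one-step refl ⟫ one-step refl) (parse-pair-rejects k s _ eq)
  parse-pair-rejects k (true ∷ true ∷ s) l none with unpair s in eq
  ... | nothing = halts-after (one-step refl ⟫ one-step refl) (parse-pair-rejects k s _ eq)

  zcells : Str → Tape
  zcells z = map (λ c → zc c false) z

  -- The comparison pass works on zigTape A y B z: A holds the pads and the y-cells
  -- already compared, B the z-cells already compared, and y, z the bits still to compare.
  zigTape : Tape → Str → Tape → Str → Tape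
  zigTape A y B z = A ++ pairCells yBlock y ++ B ++ zcells z ++ ␣ ∷ []

  roundTape : Tape → Sym → Tape → Tape → Tape
  roundTape A y₀ Mid rest = A ++ ▢ ∷ y₀ ∷ Mid ++ rest

  length-roundTape : ∀ A y₀ Mid rest → length (roundTape A y₀ Mid rest) ≡ length A + suc (suc (length Mid + length rest))
  length-roundTape A y₀ Mid rest = trans (length-++ A) (cong (λ n → length A + suc (suc n)) (length-++ Mid))

  zigTape-split : ∀ A b y B z → zigTape A (b ∷ y) B z ≡ roundTape A (yc b false) (pairCells yBlock y ++ B) (zcells z ++ ␣ ∷ [])
  zigTape-split A b y B z = cong (λ t → A ++ ▢ ∷ yc b false ∷ t) (sym (++-assoc (pairCells yBlock y) B _))

  zigTape-merge : ∀ A b y B c z →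
    roundTape A (yc b true) (pairCells yBlock y ++ B) (zc c true ∷ zcells z ++ ␣ ∷ [])
      ≡ zigTape (A ++ ▢ ∷ yc b true ∷ []) y (B ++ zc c true ∷ []) z
  zigTape-merge A b y B c z = begin
    A ++ ▢ ∷ yc b true ∷ (Y ++ B) ++ zc c true ∷ Z               ≡⟨ cong (λ t → A ++ ▢ ∷ yc b true ∷ t) (++-assoc Y B _) ⟩
    A ++ ▢ ∷ yc b true ∷ Y ++ B ++ zc c true ∷ Z                 ≡⟨ cong (λ t → A ++ ▢ ∷ yc b true ∷ Y ++ t) (sym (++-assoc B _ Z)) ⟩
    A ++ ▢ ∷ yc b true ∷ Y ++ (B ++ zc c true ∷ []) ++ Z         ≡⟨ sym (++-assoc A _ _) ⟩
    (A ++ ▢ ∷ yc b true ∷ []) ++ Y ++ (B ++ zc c true ∷ []) ++ Z ∎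
    where
    open ≡-Reasoning
    Y = pairCells yBlock y
    Z = zcells z ++ ␣ ∷ []

  zig-round-length : ∀ A b y B c z →
    length (zigTape (A ++ ▢ ∷ yc b true ∷ []) y (B ++ zc c true ∷ []) z) ≡ length (zigTape A (b ∷ y) B (c ∷ z))
  zig-round-length A b y B c z = trans (cong length (sym (zigTape-merge A b y B c z)))
    (trans (length-roundTape A _ Mid _) (trans (sym (length-roundTape A _ Mid _)) (cong length (sym (zigTape-split A b y B (c ∷ z))))))
    where
    Mid = pairCells yBlock y ++ B

  data SeekYSkips : Sym → Set where
    pad : SeekYSkips ▢
    y✓ : ∀ b → SeekYSkips (yc b true)
    z✓ : ∀ c → SeekYSkips (zc c true)

  data SeekZSkips : Sym → Set where
    pad : SeekZSkips ▢
    y-any : ∀ b m → SeekZSkips (yc b m)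
    z✓ : ∀ c → SeekZSkips (zc c true)

  data MarkedZ : Sym → Set where
    z✓ : ∀ c → MarkedZ (zc c true)

  data IsWork : Sym → Set where
    work : ∀ w → IsWork (work w)

  seekY-rule : ∀ {s a} → SeekYSkips a → δ (seekY s) a ≡ (seekY s , a , R)
  seekY-rule pad = refl
  seekY-rule (y✓ b) = refl
  seekY-rule (z✓ c) = refl

  seekZ-rule : ∀ {s b a} → SeekZSkips a → δ (seekZ s b) a ≡ (seekZ s b , a , R)
  seekZ-rule pad = refl
  seekZ-rule (y-any b m) = refl
  seekZ-rule (z✓ c) = refl

  rewind-rule : ∀ {s a} → IsWork a → δ (rewind s) a ≡ (rewind s , a , L)
  rewind-rule (work w) = refl

  seekY⇒work : ∀ {a} → SeekYSkips a → IsWork a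
  seekY⇒work pad = work pad
  seekY⇒work (y✓ b) = work _
  seekY⇒work (z✓ c) = work _

  seekZ⇒work : ∀ {a} → SeekZSkips a → IsWork a
  seekZ⇒work pad = work pad
  seekZ⇒work (y-any b m) = work _
  seekZ⇒work (z✓ c) = work _

  markedZ⇒seekY : ∀ {a} → MarkedZ a → SeekYSkips a
  markedZ⇒seekY (z✓ c) = z✓ c

  markedZ⇒seekZ : ∀ {a} → MarkedZ a → SeekZSkips a
  markedZ⇒seekZ (z✓ c) = z✓ c

  pairCells-seekZ : ∀ y → All SeekZSkips (pairCells yBlock y)
  pairCells-seekZ [] = pad ∷ pad ∷ []
  pairCells-seekZ (b ∷ y′) = pad ∷ y-any b false ∷ pairCells-seekZ y′

  middle-seekZ : ∀ y {B} → All MarkedZ B → All SeekZSkips (pairCells yBlock y ++ B)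
  middle-seekZ y Bs = ++⁺ (pairCells-seekZ y) (All.map markedZ⇒seekZ Bs)

  mark-and-seek : ∀ {s b A Mid} → All SeekYSkips A → All SeekZSkips Mid → ∀ l rest →
    Reaches (length A + (1 + (1 + length Mid)))
      (conf (seekY s) l (roundTape A (yc b false) Mid rest))
      (conf (seekZ s b) ((A ++ ▢ ∷ yc b true ∷ Mid) ʳ++ l) rest)
  mark-and-seek {s} {b} {A} {Mid} As Mids l rest =
    subst (λ l′ → Reaches _ (conf (seekY s) l (roundTape A (yc b false) Mid rest)) (conf (seekZ s b) l′ rest)) (sym (++-ʳ++ A))
      (scanRight refl SeekYSkips seekY-rule As l _
        ⟫ one-step refl
        ⟫ one-step refl
        ⟫ scanRight refl SeekZSkips seekZ-rule Mids _ rest)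

  seek-cost : ∀ a m r → a + (1 + (1 + m)) + 1 + 0 ≤ a + suc (suc (m + suc r))
  seek-cost a m r = ≤-trans (≤-reflexive (solve a m)) (+-monoʳ-≤ a (s≤s (s≤s (+-monoʳ-≤ m (s≤s z≤n)))))
    where
    solve : ∀ a m → a + (1 + (1 + m)) + 1 + 0 ≡ a + suc (suc (m + 1))
    solve = solve-∀

  seek-rejects : ∀ {s b A Mid} a rest → All SeekYSkips A → All SeekZSkips Mid → δ (seekZ s b) a ≡ (reject , a , S) →
    Rejects (length (roundTape A (yc b false) Mid (a ∷ rest))) (conf (seekY s) (␣ ∷ []) (roundTape A (yc b false) Mid (a ∷ rest)))
  seek-rejects {s} {b} {A} {Mid} a rest As Mids stuck =
    halts-mono (≤-trans (seek-cost (length A) (length Mid) (length rest)) (≤-reflexive (sym (length-roundTape A _ Mid _))))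
      (halts-after (mark-and-seek As Mids (␣ ∷ []) (a ∷ rest) ⟫ one-step (step-by {q = seekZ s b} {r = a ∷ rest} refl stuck))
        (halts-now refl refl))

  verdict-halts : ∀ s → halts (verdict s) ≡ true
  verdict-halts equal = refl
  verdict-halts flipped = refl

  verdict-accepts : ∀ s → accepts (verdict s) ≡ runCompare s [] []
  verdict-accepts equal = refl
  verdict-accepts flipped = refl

  zig-final : ∀ s A B z → All SeekYSkips A → All MarkedZ B →
    HaltsWithin (length (zigTape A [] B z)) (conf (seekY s) (␣ ∷ []) (zigTape A [] B z)) (λ c → accepts (state c) ≡ runCompare s [] z)
  zig-final s A B z As Bs =
    subst (λ t → HaltsWithin (length t) (conf (seekY s) (␣ ∷ []) t) (λ c → accepts (state c) ≡ runCompare s [] z)) (++-assoc A _ Z)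
      (halts-mono (cost z) (halts-after (scanRight refl SeekYSkips seekY-rule Seen-skips (␣ ∷ []) Z) (last-cell z)))
    where
    Seen = A ++ ▢ ∷ ▢ ∷ B
    Z = zcells z ++ ␣ ∷ []
    Seen-skips : All SeekYSkips Seen
    Seen-skips = ++⁺ As (pad ∷ pad ∷ All.map markedZ⇒seekY Bs)
    last-cell : ∀ z → HaltsWithin (1 + 0) (conf (seekY s) (Seen ʳ++ ␣ ∷ []) (zcells z ++ ␣ ∷ []))
                        (λ c → accepts (state c) ≡ runCompare s [] z)
    last-cell [] = halts-after (one-step refl) (halts-now (verdict-halts s) (verdict-accepts s))
    last-cell (c ∷ z) = halts-after (one-step refl) (halts-now refl refl)
    cost : ∀ z → length Seen + (1 + 0) ≤ length (Seen ++ zcells z ++ ␣ ∷ [])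
    cost [] = ≤-reflexive (sym (length-++ Seen))
    cost (c ∷ z) = ≤-trans (+-monoʳ-≤ (length Seen) (s≤s z≤n)) (≤-reflexive (sym (length-++ Seen)))

  compare-rule : ∀ {s s′ b c} → compareStep s b c ≡ just s′ → δ (seekZ s b) (zc c false) ≡ (rewind s′ , zc c true , L)
  compare-rule eq rewrite eq = refl

  compare-fails : ∀ {s b c} → compareStep s b c ≡ nothing → δ (seekZ s b) (zc c false) ≡ (reject , zc c false , S)
  compare-fails eq rewrite eq = refl

  round-cost : ∀ a m r → a + (1 + (1 + m)) + (suc (a + suc (suc m)) + 1) ≤ 2 * (a + suc (suc (m + suc r)))
  round-cost a m r = ≤-trans (≤-reflexive (solve a m)) (*-monoʳ-≤ 2 (+-monoʳ-≤ a (s≤s (s≤s (+-monoʳ-≤ m (s≤s z≤n))))))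
    where
    solve : ∀ a m → a + (1 + (1 + m)) + (suc (a + suc (suc m)) + 1) ≡ 2 * (a + suc (suc (m + 1)))
    solve = solve-∀

  zig-round : ∀ {s s′ b c A y B z} → compareStep s b c ≡ just s′ → All SeekYSkips A → All MarkedZ B →
    Reaches (2 * length (zigTape A (b ∷ y) B (c ∷ z)))
      (conf (seekY s) (␣ ∷ []) (zigTape A (b ∷ y) B (c ∷ z)))
      (conf (seekY s′) (␣ ∷ []) (zigTape (A ++ ▢ ∷ yc b true ∷ []) y (B ++ zc c true ∷ []) z))
  zig-round {s} {s′} {b} {c} {A} {y} {B} {z} cmp As Bs =
    subst₂ (λ t t′ → Reaches (2 * length t) (conf (seekY s) (␣ ∷ []) t) (conf (seekY s′) (␣ ∷ []) t′))
      (sym (zigTape-split A b y B (c ∷ z))) (trans (++-assoc A _ _) (zigTape-merge A b y B c z))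
      (reaches-mono cost (mark-and-seek As Mids (␣ ∷ []) (zc c false ∷ Z) ⟫ rewind-all ⟫ one-step refl))
    where
    Mid = pairCells yBlock y ++ B
    Z = zcells z ++ ␣ ∷ []
    P = A ++ ▢ ∷ yc b true ∷ Mid
    Mids = middle-seekZ y Bs
    rewind-all : Reaches (suc (length P)) (conf (seekZ s b) (P ʳ++ ␣ ∷ []) (zc c false ∷ Z)) (conf (rewind s′) [] (␣ ∷ P ++ zc c true ∷ Z))
    rewind-all = scanLeft refl IsWork rewind-rule
      (++⁺ (All.map seekY⇒work As) (work pad ∷ work _ ∷ All.map seekZ⇒work Mids)) (␣ ∷ []) (zc c false ∷ Z) refl (compare-rule cmp)
    cost : length A + (1 + (1 + length Mid)) + (suc (length P) + 1) ≤ 2 * length (roundTape A (yc b false) Mid (zc c false ∷ Z))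
    cost rewrite length-roundTape A (yc b false) Mid (zc c false ∷ Z) | length-++ A {▢ ∷ yc b true ∷ Mid} =
      round-cost (length A) (length Mid) (length Z)

  ≤-rounds : ∀ k N → N ≤ suc k * (2 * N)
  ≤-rounds k N = ≤-trans (m≤m+n N (N + 0)) (m≤m+n (2 * N) (k * (2 * N)))

  zigzag : ∀ {N} s A y B z → All SeekYSkips A → All MarkedZ B → length (zigTape A y B z) ≤ N →
    HaltsWithin (suc (length y) * (2 * N)) (conf (seekY s) (␣ ∷ []) (zigTape A y B z))
      (λ c → accepts (state c) ≡ runCompare s y z)
  zigzag {N} s A [] B z As Bs T≤N = halts-mono (≤-trans T≤N (≤-rounds 0 N)) (zig-final s A B z As Bs)
  zigzag {N} s A (b ∷ y) B [] As Bs T≤N =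
    halts-mono (≤-trans T≤N (≤-rounds (suc (length y)) N))
      (subst (λ t → Rejects (length t) (conf (seekY s) (␣ ∷ []) t)) (sym (zigTape-split A b y B []))
        (seek-rejects ␣ [] As (middle-seekZ y Bs) refl))
  zigzag {N} s A (b ∷ y) B (c ∷ z) As Bs T≤N with compareStep s b c in cmp
  ... | nothing =
    halts-mono (≤-trans T≤N (≤-rounds (suc (length y)) N))
      (subst (λ t → Rejects (length t) (conf (seekY s) (␣ ∷ []) t)) (sym (zigTape-split A b y B (c ∷ z)))
        (seek-rejects (zc c false) _ As (middle-seekZ y Bs) (compare-fails cmp)))
  ... | just s′ =
    halts-mono (+-monoˡ-≤ (suc (length y) * (2 * N)) (*-monoʳ-≤ 2 T≤N))
      (halts-after (zig-round {y = y} {z = z} cmp As Bs)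
        (zigzag s′ (A ++ ▢ ∷ yc b true ∷ []) y (B ++ zc c true ∷ []) z
          (++⁺ As (pad ∷ y✓ b ∷ [])) (++⁺ Bs (z✓ c ∷ [])) (≤-trans (≤-reflexive (zig-round-length A b y B c z)) T≤N)))

  copy-z : ∀ z l → Reaches (length z) (conf zCopy l (map bit z)) (conf zCopy (zcells z ʳ++ l) [])
  copy-z [] l = reaches-refl
  copy-z (c ∷ z) l = one-step refl ⟫ copy-z z (zc c false ∷ l)

  pairCells-work : ∀ k u → All IsWork (pairCells k u)
  pairCells-work k [] = work pad ∷ work pad ∷ []
  pairCells-work xBlock (b ∷ u) = work pad ∷ work pad ∷ pairCells-work xBlock u
  pairCells-work yBlock (b ∷ u) = work pad ∷ work _ ∷ pairCells-work yBlock u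

  pairCells-seekY : ∀ u → All SeekYSkips (pairCells xBlock u)
  pairCells-seekY [] = pad ∷ pad ∷ []
  pairCells-seekY (b ∷ u) = pad ∷ pad ∷ pairCells-seekY u

  zcells-work : ∀ z → All IsWork (zcells z)
  zcells-work [] = []
  zcells-work (c ∷ z) = work _ ∷ zcells-work z

  length-pairCells : ∀ k u → length (pairCells k u) ≡ length (double u) + 2
  length-pairCells k [] = refl
  length-pairCells k (b ∷ u) = cong (λ n → suc (suc n)) (length-pairCells k u)

  length-pair : ∀ u r → length (pair u r) ≡ length (double u) + 2 + length r
  length-pair u r = trans (length-++ (double u)) (sym (+-assoc (length (double u)) 2 _))

  length-triple : ∀ x y z → length (triple x y z) ≡ length (double x) + 2 + (length (double y) + 2 + length z)
  length-triple x y z = trans (length-pair x (pair y z)) (cong (length (double x) + 2 +_) (length-pair y z))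

  length≤double : ∀ (u : Str) → length u ≤ length (double u)
  length≤double [] = z≤n
  length≤double (b ∷ u) = s≤s (≤-trans (length≤double u) (n≤1+n _))

  +-assoc₃ : ∀ a b c k → a + (b + (c + k)) ≡ a + (b + c) + k
  +-assoc₃ = solve-∀

  parse-triple : ∀ x y z → let n = length (triple x y z) in
    Reaches (n + (suc n + 1)) (initial (triple x y z)) (conf (seekY equal) (␣ ∷ []) (zigTape (pairCells xBlock x) y [] z))
  parse-triple x y z =
    reaches-subst refl (cong (conf (seekY equal) (␣ ∷ [])) tape-eq)
      (reaches-≡ time-eq (parse-pair xBlock x (pair y z) [] ⟫ parse-pair yBlock y z _ ⟫ copy-z z _ ⟫ rewind-all ⟫ one-step refl))
    where
    X = pairCells xBlock x
    Y = pairCells yBlock y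
    seg = X ++ Y ++ zcells z
    rewind-all : Reaches (suc (length seg)) (conf zCopy (zcells z ʳ++ Y ʳ++ X ʳ++ []) []) (conf (rewind equal) [] (␣ ∷ seg ++ ␣ ∷ []))
    rewind-all = subst (λ l → Reaches (suc (length seg)) (conf zCopy l []) (conf (rewind equal) [] (␣ ∷ seg ++ ␣ ∷ [])))
      (trans (++-ʳ++ X) (++-ʳ++ Y))
      (scanLeft refl IsWork rewind-rule (++⁺ (pairCells-work xBlock x) (++⁺ (pairCells-work yBlock y) (zcells-work z))) [] [] refl refl)
    tape-eq : seg ++ ␣ ∷ [] ≡ zigTape X y [] z
    tape-eq = trans (++-assoc X _ _) (cong (X ++_) (++-assoc Y _ _))
    length-seg : length seg ≡ length (triple x y z)
    length-seg = trans (length-++ X) (trans (cong₂ _+_ (length-pairCells xBlock x)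
      (trans (length-++ Y) (cong₂ _+_ (length-pairCells yBlock y) (length-map _ z)))) (sym (length-triple x y z)))
    time-eq : length (double x) + 2 + (length (double y) + 2 + (length z + (suc (length seg) + 1)))
                ≡ length (triple x y z) + (suc (length (triple x y z)) + 1)
    time-eq = trans (+-assoc₃ (length (double x) + 2) (length (double y) + 2) (length z) (suc (length seg) + 1))
      (cong₂ (λ n m → n + (suc m + 1)) (sym (length-triple x y z)) length-seg)

  length-zigTape-parsed : ∀ x y z → length (zigTape (pairCells xBlock x) y [] z) ≡ length (triple x y z) + 1
  length-zigTape-parsed x y z = begin
    length (X ++ Y ++ zcells z ++ ␣ ∷ [])                                 ≡⟨ length-++ X ⟩
    length X + length (Y ++ zcells z ++ ␣ ∷ [])                           ≡⟨ cong (length X +_) (length-++ Y) ⟩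
    length X + (length Y + length (zcells z ++ ␣ ∷ []))                   ≡⟨ cong (λ m → length X + (length Y + m)) (length-++ (zcells z)) ⟩
    length X + (length Y + (length (zcells z) + 1))                       ≡⟨ +-assoc₃ (length X) (length Y) (length (zcells z)) 1 ⟩
    length X + (length Y + length (zcells z)) + 1                         ≡⟨ cong (_+ 1) lengths ⟩
    length (triple x y z) + 1                                             ∎
    where
    open ≡-Reasoning
    X = pairCells xBlock x
    Y = pairCells yBlock y
    lengths : length X + (length Y + length (zcells z)) ≡ length (triple x y z)
    lengths = trans (cong₂ _+_ (length-pairCells xBlock x) (cong₂ _+_ (length-pairCells yBlock y) (length-map _ z)))
                    (sym (length-triple x y z))

  lexTime : Poly
  lexTime = 4 ∷ 6 ∷ 2 ∷ []

  lex-cost : ∀ n k → k ≤ n → n + (suc n + 1) + suc k * (2 * (n + 1)) ≤ evalP lexTime n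
  lex-cost n k k≤n = ≤-trans (+-monoʳ-≤ (n + (suc n + 1)) (*-monoˡ-≤ (2 * (n + 1)) (s≤s k≤n))) (≤-reflexive (solve n))
    where
    solve : ∀ n → n + (suc n + 1) + suc n * (2 * (n + 1)) ≡ 4 + n * (6 + n * (2 + n * 0))
    solve = solve-∀

  run-triple : ∀ x y z → let n = length (triple x y z) in
    HaltsWithin (evalP lexTime n) (initial (triple x y z)) (λ c → accepts (state c) ≡ isLexSucc y z)
  run-triple x y z =
    halts-mono (subst (λ t → n + (suc n + 1) + suc (length y) * (2 * t) ≤ evalP lexTime n) (sym (length-zigTape-parsed x y z))
                 (lex-cost n (length y) y≤n))
      (halts-after (parse-triple x y z) (zigzag equal (pairCells xBlock x) y [] z (pairCells-seekY x) [] ≤-refl))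
    where
    n = length (triple x y z)
    y≤n : length y ≤ n
    y≤n = ≤-trans (length≤double y) (≤-trans (m≤m+n _ 2) (≤-trans (m≤m+n _ (length z))
            (≤-trans (m≤n+m _ (length (double x) + 2)) (≤-reflexive (sym (length-triple x y z))))))

  suc≤lexTime : ∀ n → suc n ≤ evalP lexTime n
  suc≤lexTime n = s≤s (≤-trans (m≤m*n n (6 + n * (2 + n * 0))) (m≤n+m _ 3))

  second-rejects : ∀ x r → unpair r ≡ nothing → Rejects (suc (length (pair x r))) (initial (pair x r))
  second-rejects x r none =
    halts-mono (≤-reflexive (trans (+-suc (length (double x) + 2) (length r)) (cong suc (sym (length-pair x r)))))
      (halts-after (parse-pair xBlock x r []) (parse-pair-rejects yBlock r _ none))

  lex-decides : ∀ s → HaltsWithin (evalP lexTime (length s)) (initial s) (λ c → accepts (state c) ≡ lexPrec s)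
  lex-decides s with unpair s in parsed-x
  ... | nothing = halts-mono (suc≤lexTime (length s)) (parse-pair-rejects xBlock s [] parsed-x)
  ... | just (x , r) with unpair r in parsed-y
  ...   | nothing rewrite unpair-sound s parsed-x = halts-mono (suc≤lexTime _) (second-rejects x r parsed-y)
  ...   | just (y , z) rewrite unpair-sound s parsed-x | unpair-sound r parsed-y = run-triple x y z

  blockCode : Block ↪ Fin 2
  blockCode = retract-code (λ { xBlock → false ; yBlock → true }) (λ { false → xBlock ; true → yBlock })
    (λ { xBlock → refl ; yBlock → refl }) Bool-code

  phaseCode : Phase ↪ Fin 2
  phaseCode = retract-code (λ { equal → false ; flipped → true }) (λ { false → equal ; true → flipped })
    (λ { equal → refl ; flipped → refl }) Bool-code

  cellCode : Cell ↪ Fin 9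
  cellCode = retract-code to from (λ { pad → refl ; (ycell b m) → refl ; (zcell c m) → refl })
    (⊎-code ⊤-code (⊎-code (×-code Bool-code Bool-code) (×-code Bool-code Bool-code)))
    where
    to : Cell → ⊤ ⊎ (Bool × Bool) ⊎ (Bool × Bool)
    to pad = inj₁ tt
    to (ycell b m) = inj₂ (inj₁ (b , m))
    to (zcell c m) = inj₂ (inj₂ (c , m))
    from : ⊤ ⊎ (Bool × Bool) ⊎ (Bool × Bool) → Cell
    from (inj₁ _) = pad
    from (inj₂ (inj₁ (b , m))) = ycell b m
    from (inj₂ (inj₂ (c , m))) = zcell c m

  stateCode : LexState ↪ Fin 17
  stateCode = retract-code to from from-to
    (⊎-code blockCode (⊎-code (×-code blockCode Bool-code) (⊎-code ⊤-code (⊎-code phaseCode (⊎-code phaseCode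
      (⊎-code (×-code phaseCode Bool-code) (⊎-code ⊤-code ⊤-code)))))))
    where
    Code = Block ⊎ (Block × Bool) ⊎ ⊤ ⊎ Phase ⊎ Phase ⊎ (Phase × Bool) ⊎ ⊤ ⊎ ⊤
    to : LexState → Code
    to (first k) = inj₁ k
    to (second k b) = inj₂ (inj₁ (k , b))
    to zCopy = inj₂ (inj₂ (inj₁ tt))
    to (rewind s) = inj₂ (inj₂ (inj₂ (inj₁ s)))
    to (seekY s) = inj₂ (inj₂ (inj₂ (inj₂ (inj₁ s))))
    to (seekZ s b) = inj₂ (inj₂ (inj₂ (inj₂ (inj₂ (inj₁ (s , b))))))
    to accept = inj₂ (inj₂ (inj₂ (inj₂ (inj₂ (inj₂ (inj₁ tt))))))
    to reject = inj₂ (inj₂ (inj₂ (inj₂ (inj₂ (inj₂ (inj₂ tt))))))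
    from : Code → LexState
    from (inj₁ k) = first k
    from (inj₂ (inj₁ (k , b))) = second k b
    from (inj₂ (inj₂ (inj₁ _))) = zCopy
    from (inj₂ (inj₂ (inj₂ (inj₁ s)))) = rewind s
    from (inj₂ (inj₂ (inj₂ (inj₂ (inj₁ s))))) = seekY s
    from (inj₂ (inj₂ (inj₂ (inj₂ (inj₂ (inj₁ (s , b))))))) = seekZ s b
    from (inj₂ (inj₂ (inj₂ (inj₂ (inj₂ (inj₂ (inj₁ _))))))) = accept
    from (inj₂ (inj₂ (inj₂ (inj₂ (inj₂ (inj₂ (inj₂ _))))))) = reject
    from-to : ∀ q → from (to q) ≡ q
    from-to (first k) = refl
    from-to (second k b) = refl
    from-to zCopy = refl
    from-to (rewind s) = refl
    from-to (seekY s) = refl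
    from-to (seekZ s b) = refl
    from-to accept = refl
    from-to reject = refl

  lexPrec-PolyTimeDec : PolyTimeDec lexPrec
  lexPrec-PolyTimeDec = Compile.decides lexMachine stateCode cellCode lexPrec lexTime lex-decides

-- The machine writing v^p(n)

marked : ∀ {k} → ℕ → Vec Bool k → Bool
marked i [] = false
marked zero (b ∷ m) = b
marked (suc i) (b ∷ m) = marked i m

setMark : ∀ {k} → ℕ → Bool → Vec Bool k → Vec Bool k
setMark i x [] = []
setMark zero x (b ∷ m) = x ∷ m
setMark (suc i) x (b ∷ m) = b ∷ setMark i x m

marked-setMark : ∀ {k} i x (m : Vec Bool k) → i < k → marked i (setMark i x m) ≡ x
marked-setMark zero x (b ∷ m) _ = refl
marked-setMark (suc i) x (b ∷ m) (s≤s i<k) = marked-setMark i x m i<k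

marked-setMark-≢ : ∀ {k} i j x (m : Vec Bool k) → i ≢ j → marked i (setMark j x m) ≡ marked i m
marked-setMark-≢ i j x [] _ = refl
marked-setMark-≢ zero zero x (b ∷ m) i≢j = contradiction refl i≢j
marked-setMark-≢ zero (suc j) x (b ∷ m) _ = refl
marked-setMark-≢ (suc i) zero x (b ∷ m) _ = refl
marked-setMark-≢ (suc i) (suc j) x (b ∷ m) i≢j = marked-setMark-≢ i j x m (i≢j ∘ cong suc)

setMark-setMark : ∀ {k} i (m : Vec Bool k) → marked i m ≡ false → setMark i false (setMark i true m) ≡ m
setMark-setMark i [] _ = refl
setMark-setMark zero (b ∷ m) refl = refl
setMark-setMark (suc i) (b ∷ m) unmarked = cong (b ∷_) (setMark-setMark i m unmarked)

marked-replicate : ∀ {k} i → marked i (Vec.replicate k false) ≡ false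
marked-replicate {zero} i = refl
marked-replicate {suc k} zero = refl
marked-replicate {suc k} (suc i) = marked-replicate {k} i

UnmarkedFrom : ∀ {k} → ℕ → Vec Bool k → Set
UnmarkedFrom j m = ∀ i → j ≤ i → marked i m ≡ false

UnmarkedFrom-suc : ∀ {k} {j} {m : Vec Bool k} → UnmarkedFrom j m → UnmarkedFrom (suc j) m
UnmarkedFrom-suc unmarked i j<i = unmarked i (<⇒≤ j<i)

UnmarkedFrom-setMark : ∀ {k} {j} x {m : Vec Bool k} → UnmarkedFrom (suc j) m → UnmarkedFrom (suc j) (setMark j x m)
UnmarkedFrom-setMark {j = j} x {m} unmarked i j<i = trans (marked-setMark-≢ i j x m (λ { refl → <-irrefl refl j<i })) (unmarked i j<i)

drop-< : ∀ (xs : List ℕ) j {c cs} → drop j xs ≡ c ∷ cs → j < length xs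
drop-< (x ∷ xs) zero _ = s≤s z≤n
drop-< (x ∷ xs) (suc j) eq = s≤s (drop-< xs j eq)

drop-≤sum : ∀ (xs : List ℕ) j {c cs} → drop j xs ≡ c ∷ cs → c ≤ sum xs
drop-≤sum (x ∷ xs) zero refl = m≤m+n x (sum xs)
drop-≤sum (x ∷ xs) (suc j) eq = ≤-trans (drop-≤sum xs j eq) (m≤n+m (sum xs) x)

drop-suc : ∀ (xs : List ℕ) j {c cs} → drop j xs ≡ c ∷ cs → drop (suc j) xs ≡ cs
drop-suc (x ∷ xs) zero refl = refl
drop-suc (x ∷ xs) (suc j) eq = drop-suc xs j eq

uniformPath : Poly → Bool → Str → Str
uniformPath p v x = toList (replicate (evalP p (length x)) v)

-- Horner's rule: level j writes the coefficient cⱼ and then runs level j+1 once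
-- for every input cell.  Each input cell carries one mark per level, recording how
-- far the loop of that level has got.  The output grows leftwards from a hash
-- written just left of the input.
module UnaryMachine (p : Poly) (v : Bool) where

  K C : ℕ
  K = length p
  C = sum p  -- bounds every coefficient, hence the emission counter

  Marks : Set
  Marks = Vec Bool K

  data Tally : Set where
    hash : Tally
    cell : Marks → Tally

  data UState : Set where
    convert rewindInput finish done : UState
    emit toOutputEnd toHash : Below K → Below (suc C) → UState
    loop seek back clear : Below K → UState
    ret : Below (suc K) → UState

  enterWith : ∀ j → .(j < suc K) → (cs : Poly) → drop j p ≡ cs → UState
  enterWith j j≤K [] _ = ret (below j j≤K)
  enterWith j j≤K (c ∷ cs) eq = emit (below j (drop-< p j eq)) (below c (s≤s (drop-≤sum p j eq)))

  enter : Below (suc K) → UState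
  enter (below j j≤K) = enterWith j j≤K (drop j p) refl

  Sym : Set
  Sym = Symbol Tally

  cellS : Marks → Sym
  cellS m = work (cell m)

  δ : UState → Sym → UState × Sym × Move
  δ convert (bit b) = convert , cellS (Vec.replicate K false) , R
  δ convert ␣ = rewindInput , ␣ , L
  δ rewindInput (work w) = rewindInput , work w , L
  δ rewindInput ␣ = enter (below 0 (s≤s z≤n)) , work hash , S
  δ (emit j (below zero _)) a = loop j , a , S
  δ (emit j (below (suc r) r<)) a = toOutputEnd j (below r (≤-trans (n≤1+n _) r<)) , a , L
  δ (toOutputEnd j r) (bit b) = toOutputEnd j r , bit b , L
  δ (toOutputEnd j r) ␣ = toHash j r , bit v , R
  δ (toHash j r) (bit b) = toHash j r , bit b , R
  δ (toHash j r) (work hash) = emit j r , work hash , S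
  δ (loop j) a = seek j , a , R
  δ (seek j) (work (cell m)) =
    if marked (Below.value j) m then (seek j , cellS m , R) else (back j , cellS (setMark (Below.value j) true m) , L)
  δ (seek j) ␣ = clear j , ␣ , L
  δ (back j) (work (cell m)) = back j , cellS m , L
  δ (back (below j j<K)) (work hash) = enter (below (suc j) (s≤s j<K)) , work hash , S
  δ (clear j) (work (cell m)) = clear j , cellS (setMark (Below.value j) false m) , L
  δ (clear (below j j<K)) (work hash) = ret (below j (≤-trans j<K (n≤1+n K))) , work hash , S
  δ (ret (below zero _)) a = finish , a , L
  δ (ret (below (suc j) j<K)) a = loop (below j (s≤s⁻¹ j<K)) , a , S
  δ finish (bit b) = finish , bit b , L
  δ finish ␣ = done , ␣ , R
  δ q a = q , a , S  -- not reached from an initial configuration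

  halts : UState → Bool
  halts done = true
  halts _ = false

  unaryMachine : Machine
  unaryMachine = record
    { State = UState ; Work = Tally ; start = convert
    ; halts = halts ; accepts = halts ; δ = δ }

  open Run unaryMachine

  outs : ℕ → Tape
  outs o = List.replicate o (bit v)

  cells : List Marks → Tape
  cells ms = map cellS ms

  tally : UState → ℕ → List Marks → Cfg
  tally q o ms = conf q (outs o) (work hash ∷ cells ms ++ ␣ ∷ [])

  data IsBit : Sym → Set where
    bit : ∀ b → IsBit (bit b)

  data IsCell : Sym → Set where
    cell : ∀ m → IsCell (cellS m)

  outs-IsBit : ∀ o → All IsBit (outs o)
  outs-IsBit zero = []
  outs-IsBit (suc o) = bit v ∷ outs-IsBit o

  cells-IsCell : ∀ ms → All IsCell (cells ms)
  cells-IsCell [] = []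
  cells-IsCell (m ∷ ms) = cell m ∷ cells-IsCell ms

  outs-ʳ++ : ∀ o l → outs o ʳ++ l ≡ outs o ++ l
  outs-ʳ++ zero l = refl
  outs-ʳ++ (suc o) l = trans (outs-ʳ++ o (bit v ∷ l)) (outs-∷ o)
    where
    outs-∷ : ∀ o → outs o ++ bit v ∷ l ≡ bit v ∷ outs o ++ l
    outs-∷ zero = refl
    outs-∷ (suc o) = cong (bit v ∷_) (outs-∷ o)

  outs-reversed : ∀ o → outs o ʳ++ [] ≡ outs o
  outs-reversed o = trans (outs-ʳ++ o []) (++-identityʳ (outs o))

  emit-one : ∀ j r .(r< : suc r < suc C) o ms → Reaches (suc o + (1 + (o + 1)))
    (tally (emit j (below (suc r) r<)) o ms) (tally (emit j (below r (≤-trans (n≤1+n _) r<))) (suc o) ms)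
  emit-one j r r< o ms =
    subst₂ (λ l l′ → Reaches (suc o + (1 + (o + 1))) (conf (emit j (below (suc r) r<)) l rest) (conf (emit j r′) l′ rest))
      (outs-reversed o) (outs-reversed (suc o))
      (reaches-≡ (cong (λ n → suc n + (1 + (n + 1))) (length-replicate o))
        (scanLeft refl IsBit (λ { (bit b) → refl }) (outs-IsBit o) [] rest refl refl
          ⟫ one-step refl
          ⟫ scanRight refl IsBit (λ { (bit b) → refl }) (outs-IsBit o) (bit v ∷ []) rest
          ⟫ one-step refl))
    where
    rest = work hash ∷ cells ms ++ ␣ ∷ []
    r′ = below r (≤-trans (n≤1+n _) r<)

  walk-cost : ∀ o U → o ≤ U → suc o + (1 + (o + 1)) ≤ 2 * U + 3
  walk-cost o U o≤U = ≤-trans (≤-reflexive (solve o)) (+-monoˡ-≤ 3 (*-monoʳ-≤ 2 o≤U))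
    where
    solve : ∀ o → suc o + (1 + (o + 1)) ≡ 2 * o + 3
    solve = solve-∀

  emits : ∀ j r .(r< : r < suc C) o ms U → o + r ≤ U →
    Reaches (r * (2 * U + 3) + 1) (tally (emit j (below r r<)) o ms) (tally (loop j) (o + r) ms)
  emits j zero r< o ms U _ =
    subst (λ o′ → Reaches 1 (tally (emit j (below 0 r<)) o ms) (tally (loop j) o′ ms)) (sym (+-identityʳ o)) (one-step refl)
  emits j (suc r) r< o ms U o+r≤U =
    subst (λ o′ → Reaches (suc r * (2 * U + 3) + 1) (tally (emit j (below (suc r) r<)) o ms) (tally (loop j) o′ ms)) (sym (+-suc o r))
      (reaches-mono cost (emit-one j r r< o ms ⟫ emits j r _ (suc o) ms U (≤-trans (≤-reflexive (sym (+-suc o r))) o+r≤U)))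
    where
    cost : suc o + (1 + (o + 1)) + (r * (2 * U + 3) + 1) ≤ suc r * (2 * U + 3) + 1
    cost = ≤-trans (+-monoˡ-≤ _ (walk-cost o U (≤-trans (m≤m+n o (suc r)) o+r≤U)))
             (≤-reflexive (sym (+-assoc (2 * U + 3) (r * (2 * U + 3)) 1)))

  enter-nil : ∀ j .(j≤K : j < suc K) → drop j p ≡ [] → enter (below j j≤K) ≡ ret (below j j≤K)
  enter-nil j j≤K eq = go (drop j p) refl eq
    where
    go : ∀ cs (e : drop j p ≡ cs) → cs ≡ [] → enterWith j j≤K cs e ≡ ret (below j j≤K)
    go .[] _ refl = refl

  enter-cons : ∀ j .(j≤K : j < suc K) {c cs} (eq : drop j p ≡ c ∷ cs) →
    enter (below j j≤K) ≡ emit (below j (drop-< p j eq)) (below c (s≤s (drop-≤sum p j eq)))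
  enter-cons j j≤K {c} {cs} eq = go (drop j p) refl eq
    where
    go : ∀ ds (e : drop j p ≡ ds) → ds ≡ c ∷ cs →
      enterWith j j≤K ds e ≡ emit (below j (drop-< p j eq)) (below c (s≤s (drop-≤sum p j eq)))
    go .(c ∷ cs) _ refl = refl

  cells-++ : ∀ ms ms′ → cells (ms ++ ms′) ++ ␣ ∷ [] ≡ cells ms ++ cells ms′ ++ ␣ ∷ []
  cells-++ ms ms′ = trans (cong (_++ ␣ ∷ []) (map-++ cellS ms ms′)) (++-assoc (cells ms) (cells ms′) _)

  module Level (j : ℕ) .(j<K : j < K) where

    ℓ : Below K
    ℓ = below j j<K

    this next : Below (suc K)
    this = below j (≤-trans j<K (n≤1+n K))
    next = below (suc j) (s≤s j<K)

    j<K′ : j < K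
    j<K′ = recompute (j <? K) j<K

    mark : Marks → Marks
    mark = setMark j true

    data MarkedHere : Sym → Set where
      marked-here : ∀ m → marked j m ≡ true → MarkedHere (cellS m)

    seek-rule : ∀ {a} → MarkedHere a → δ (seek ℓ) a ≡ (seek ℓ , a , R)
    seek-rule (marked-here m eq) rewrite eq = refl

    mark-marked : ∀ A → All MarkedHere (cells (map mark A))
    mark-marked [] = []
    mark-marked (m ∷ A) = marked-here (mark m) (marked-setMark j true m j<K′) ∷ mark-marked A

    length-cells-mark : ∀ A → length (cells (map mark A)) ≡ length A
    length-cells-mark A = trans (length-map cellS (map mark A)) (length-map mark A)

    unmark : Sym → Sym
    unmark (work (cell m)) = cellS (setMark j false m)
    unmark a = a

    unmark-mark : ∀ A → All (UnmarkedFrom j) A → map unmark (cells (map mark A)) ≡ cells A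
    unmark-mark [] [] = refl
    unmark-mark (m ∷ A) (um ∷ ums) = cong₂ _∷_ (cong cellS (setMark-setMark j m (um j ≤-refl))) (unmark-mark A ums)

    step-into : ∀ A m ms o → UnmarkedFrom j m →
      Reaches (1 + (length A + (suc (length A) + 1)))
        (tally (loop ℓ) o (map mark A ++ m ∷ ms)) (tally (enter next) o (map mark A ++ mark m ∷ ms))
    step-into A m ms o um =
      subst₂ (λ t t′ → Reaches (1 + (length A + (suc (length A) + 1))) (conf (loop ℓ) (outs o) (work hash ∷ t))
                         (conf (enter next) (outs o) (work hash ∷ t′)))
        (sym (cells-++ (map mark A) (m ∷ ms))) (sym (cells-++ (map mark A) (mark m ∷ ms)))
        (reaches-≡ (cong (λ a → 1 + (a + (suc a + 1))) (length-cells-mark A))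
          (one-step refl
           ⟫ scanRight refl MarkedHere seek-rule (mark-marked A) _ _
           ⟫ scanLeft refl IsCell (λ { (cell m) → refl }) (cells-IsCell (map mark A)) _ _ refl found
           ⟫ one-step refl))
      where
      found : δ (seek ℓ) (cellS m) ≡ (back ℓ , cellS (mark m) , L)
      found rewrite um j ≤-refl = refl

    step-out : ∀ A o → All (UnmarkedFrom j) A →
      Reaches (1 + (length A + (suc (length A) + 1))) (tally (loop ℓ) o (map mark A)) (tally (ret this) o A)
    step-out A o ums =
      subst (λ t → Reaches (1 + (length A + (suc (length A) + 1))) (tally (loop ℓ) o (map mark A))
                     (conf (ret this) (outs o) (work hash ∷ t ++ ␣ ∷ [])))
        (unmark-mark A ums)
        (reaches-≡ (cong (λ a → 1 + (a + (suc a + 1))) (length-cells-mark A))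
          (one-step refl
           ⟫ scanRight refl MarkedHere seek-rule (mark-marked A) _ (␣ ∷ [])
           ⟫ rewriteLeft {q = clear ℓ} refl IsCell unmark (λ { (cell m) → refl }) (cells-IsCell (map mark A))
               {q₀ = seek ℓ} (work hash ∷ outs o) (␣ ∷ []) refl refl
           ⟫ one-step refl))

    iteration-cost : ∀ a b tb rest n → a + suc b ≡ n → 1 + (a + (suc a + 1)) + (tb + (1 + rest)) ≤ 2 * n + 4 + tb + rest
    iteration-cost a b tb rest n a+b<n =
      ≤-trans (≤-reflexive (solve a tb rest)) (+-monoˡ-≤ rest (+-monoˡ-≤ tb (+-monoˡ-≤ 4 (*-monoʳ-≤ 2 a≤n))))
      where
      solve : ∀ a tb rest → 1 + (a + (suc a + 1)) + (tb + (1 + rest)) ≡ 2 * a + 4 + tb + rest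
      solve = solve-∀
      a≤n : a ≤ n
      a≤n = ≤-trans (m≤m+n a (suc b)) (≤-reflexive a+b<n)

    module Loop (n w tb U : ℕ)
      (body : ∀ o ms → length ms ≡ n → All (UnmarkedFrom (suc j)) ms → o + w ≤ U →
              Reaches tb (tally (enter next) o ms) (tally (ret next) (o + w) ms)) where

      loop-all : ∀ A B o → All (UnmarkedFrom j) A → All (UnmarkedFrom j) B → length A + length B ≡ n → o + length B * w ≤ U →
        Reaches (length B * (2 * n + 4 + tb) + (2 * n + 3)) (tally (loop ℓ) o (map mark A ++ B)) (tally (ret this) (o + length B * w) (A ++ B))
      loop-all A [] o umsA [] len _ =
        reaches-subst (cong (tally (loop ℓ) o) (sym (++-identityʳ (map mark A))))
                      (cong₂ (tally (ret this)) (sym (+-identityʳ o)) (sym (++-identityʳ A)))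
          (reaches-mono (≤-reflexive (trans (solve (length A)) (cong (λ a → 2 * a + 3) (trans (sym (+-identityʳ _)) len))))
            (step-out A o umsA))
        where
        solve : ∀ a → 1 + (a + (suc a + 1)) ≡ 2 * a + 3
        solve = solve-∀
      loop-all A (m ∷ B) o umsA (um ∷ umsB) len o+w≤U =
        reaches-subst refl (cong₂ (tally (ret this)) (+-assoc o w _) (++-assoc A (m ∷ []) B))
          (reaches-mono cost
            (step-into A m B o um
             ⟫ body o (map mark A ++ mark m ∷ B) length-marked unmarked-above (≤-trans (+-monoʳ-≤ o (m≤m+n w _)) o+w≤U)
             ⟫ one-step refl
             ⟫ reaches-subst (cong (tally (loop ℓ) (o + w)) shift) refl
                 (loop-all (A ++ m ∷ []) B (o + w) (++⁺ umsA (um ∷ [])) umsB length-shifted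
                   (≤-trans (≤-reflexive (+-assoc o w _)) o+w≤U))))
        where
        shift : map mark (A ++ m ∷ []) ++ B ≡ map mark A ++ mark m ∷ B
        shift = trans (cong (_++ B) (map-++ mark A (m ∷ []))) (++-assoc (map mark A) (mark m ∷ []) B)
        length-shifted : length (A ++ m ∷ []) + length B ≡ n
        length-shifted = trans (cong (_+ length B) (length-++ A)) (trans (+-assoc (length A) 1 (length B)) len)
        length-marked : length (map mark A ++ mark m ∷ B) ≡ n
        length-marked = trans (length-++ (map mark A)) (trans (cong (_+ suc (length B)) (length-map mark A)) len)
        unmarked-above : All (UnmarkedFrom (suc j)) (map mark A ++ mark m ∷ B)
        unmarked-above = ++⁺ (map⁺ (All.map (λ {m} u → UnmarkedFrom-setMark true {m} (UnmarkedFrom-suc {m = m} u)) umsA))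
                             (UnmarkedFrom-setMark true {m} (UnmarkedFrom-suc {m = m} um) ∷ All.map (λ {m} → UnmarkedFrom-suc {m = m}) umsB)
        cost : 1 + (length A + (suc (length A) + 1)) + (tb + (1 + (length B * (2 * n + 4 + tb) + (2 * n + 3))))
                 ≤ suc (length B) * (2 * n + 4 + tb) + (2 * n + 3)
        cost = ≤-trans (iteration-cost (length A) (length B) tb _ n len)
                 (≤-reflexive (sym (+-assoc (2 * n + 4 + tb) (length B * (2 * n + 4 + tb)) (2 * n + 3))))

  -- U bounds the length of the output throughout, so walking to its far end and
  -- back to the hash takes at most 2U + 3 steps.
  levelTime : Poly → ℕ → ℕ → ℕ
  levelTime [] n U = 0
  levelTime (c ∷ cs) n U = (c * (2 * U + 3) + 1) + (n * (2 * n + 4 + levelTime cs n U) + (2 * n + 3))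

  level : ∀ cs j .(j≤K : j < suc K) → drop j p ≡ cs → ∀ o ms U → All (UnmarkedFrom j) ms → o + evalP cs (length ms) ≤ U →
    Reaches (levelTime cs (length ms) U)
      (tally (enter (below j j≤K)) o ms) (tally (ret (below j j≤K)) (o + evalP cs (length ms)) ms)
  level [] j j≤K eq o ms U _ _ =
    reaches-subst (cong (λ q → tally q o ms) (sym (enter-nil j j≤K eq))) (cong (λ o′ → tally (ret (below j j≤K)) o′ ms) (sym (+-identityʳ o)))
      reaches-refl
  level (c ∷ cs) j j≤K eq o ms U ums bound =
    reaches-subst (cong (λ q → tally q o ms) (sym (enter-cons j j≤K eq))) (cong (λ o′ → tally (ret (below j j≤K)) o′ ms) (+-assoc o c _))
      (emits (below j j<K) c _ o ms U (≤-trans (m≤m+n (o + c) _) bound′)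
       ⟫ Level.Loop.loop-all j j<K n w (levelTime cs n U) U body [] ms (o + c) [] ums refl bound′)
    where
    j<K = drop-< p j eq
    n = length ms
    w = evalP cs n
    bound′ : o + c + n * w ≤ U
    bound′ = ≤-trans (≤-reflexive (+-assoc o c _)) bound
    body : ∀ o′ ms′ → length ms′ ≡ n → All (UnmarkedFrom (suc j)) ms′ → o′ + w ≤ U →
      Reaches (levelTime cs n U) (tally (enter (below (suc j) (s≤s j<K))) o′ ms′) (tally (ret (below (suc j) (s≤s j<K))) (o′ + w) ms′)
    body o′ ms′ len ums′ b = subst (λ k → Reaches (levelTime cs k U) (tally (enter (below (suc j) (s≤s j<K))) o′ ms′)
                                                  (tally (ret (below (suc j) (s≤s j<K))) (o′ + evalP cs k) ms′)) len
      (level cs (suc j) (s≤s j<K) (drop-suc p j eq) o′ ms′ U ums′ (subst (λ k → o′ + evalP cs k ≤ U) (sym len) b))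

  blanks : Str → List Marks
  blanks x = map (λ _ → Vec.replicate K false) x

  convert-input : ∀ x l → Reaches (length x) (conf convert l (map bit x)) (conf convert (cells (blanks x) ʳ++ l) [])
  convert-input [] l = reaches-refl
  convert-input (b ∷ x) l = one-step refl ⟫ convert-input x (cellS _ ∷ l)

  prepare : ∀ x → Reaches (length x + (suc (length x) + 1)) (initial x) (tally (enter (below 0 (s≤s z≤n))) 0 (blanks x))
  prepare x =
    convert-input x []
    ⟫ reaches-≡ (cong suc (trans (length-map cellS (blanks x)) (length-map _ x)))
        (scanLeft refl IsCell (λ { (cell m) → refl }) (cells-IsCell (blanks x)) [] [] refl refl)
    ⟫ one-step refl

  blanks-unmarked : ∀ x → All (UnmarkedFrom 0) (blanks x)
  blanks-unmarked [] = []
  blanks-unmarked (_ ∷ x) = (λ i _ → marked-replicate {K} i) ∷ blanks-unmarked x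

  wrap-up : ∀ P ms → Reaches (suc P + 1) (tally (ret (below 0 (s≤s z≤n))) P ms) (conf done (␣ ∷ []) (outs P ++ work hash ∷ cells ms ++ ␣ ∷ []))
  wrap-up P ms =
    reaches-subst (cong (λ l → conf (ret (below 0 (s≤s z≤n))) l (work hash ∷ cells ms ++ ␣ ∷ [])) (outs-reversed P)) refl
      (reaches-≡ (cong (λ n → suc n + 1) (length-replicate P))
        (scanLeft refl IsBit (λ { (bit b) → refl }) (outs-IsBit P) [] (work hash ∷ cells ms ++ ␣ ∷ []) refl refl
         ⟫ one-step refl))

  bits-outs : ∀ P t → bits (outs P ++ work hash ∷ t) ≡ List.replicate P v
  bits-outs zero t = refl
  bits-outs (suc P) t = cong (v ∷_) (bits-outs P t)

  unaryTime : ℕ → ℕ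
  unaryTime n = n + (suc n + 1) + (levelTime p n (evalP p n) + (suc (evalP p n) + 1))

  writes : ∀ x → HaltsWithin (unaryTime (length x)) (initial x) (λ c → bits (right c) ≡ List.replicate (evalP p (length x)) v)
  writes x = halts-mono (≤-reflexive (+-identityʳ _))
    (halts-after (prepare x ⟫ run-levels ⟫ wrap-up P (blanks x)) (halts-now refl (bits-outs P _)))
    where
    n = length x
    P = evalP p n
    length-blanks : length (blanks x) ≡ n
    length-blanks = length-map _ x
    run-levels : Reaches (levelTime p n P) (tally (enter (below 0 (s≤s z≤n))) 0 (blanks x)) (tally (ret (below 0 (s≤s z≤n))) P (blanks x))
    run-levels = subst (λ k → Reaches (levelTime p k P) (tally (enter (below 0 (s≤s z≤n))) 0 (blanks x))
                                        (tally (ret (below 0 (s≤s z≤n))) (evalP p k) (blanks x))) length-blanks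
      (level p 0 (s≤s z≤n) refl 0 (blanks x) P (blanks-unmarked x) (≤-reflexive (cong (evalP p) length-blanks)))

  unaryTime-bounded : PolyBounded unaryTime
  unaryTime-bounded =
    bounded-+ (bounded-+ bounded-id (bounded-+ (bounded-+ (bounded-const 1) bounded-id) (bounded-const 1)))
      (bounded-+ (levelTime-bounded p) (bounded-+ (bounded-+ (bounded-const 1) (bounded-evalP p)) (bounded-const 1)))
    where
    levelTime-bounded : ∀ cs → PolyBounded (λ n → levelTime cs n (evalP p n))
    levelTime-bounded [] = bounded-const 0
    levelTime-bounded (c ∷ cs) =
      bounded-+ (bounded-+ (bounded-* (bounded-const c) (walk (bounded-evalP p) 3)) (bounded-const 1))
        (bounded-+ (bounded-* bounded-id (bounded-+ (walk bounded-id 4) (levelTime-bounded cs))) (walk bounded-id 3))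
      where
      walk : ∀ {f} → PolyBounded f → ∀ k → PolyBounded (λ n → 2 * f n + k)
      walk bf k = bounded-+ (bounded-* (bounded-const 2) bf) (bounded-const k)

  tallyCode : Tally ↪ Fin (1 + 2 ^ K)
  tallyCode = retract-code (λ { hash → inj₁ tt ; (cell m) → inj₂ m }) (λ { (inj₁ _) → hash ; (inj₂ m) → cell m })
    (λ { hash → refl ; (cell m) → refl }) (⊎-code ⊤-code (Vec-code K))

  stateCode : UState ↪ Fin _
  stateCode = retract-code to from from-to
    (⊎-code ⊤-code (⊎-code ⊤-code (⊎-code ⊤-code (⊎-code ⊤-code (⊎-code walkCode (⊎-code walkCode (⊎-code walkCode
      (⊎-code levelCode (⊎-code levelCode (⊎-code levelCode (⊎-code levelCode (Below-code (suc K)))))))))))))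
    where
    levelCode = Below-code K
    walkCode = ×-code levelCode (Below-code (suc C))
    W = Below K × Below (suc C)
    Code = ⊤ ⊎ ⊤ ⊎ ⊤ ⊎ ⊤ ⊎ W ⊎ W ⊎ W ⊎ Below K ⊎ Below K ⊎ Below K ⊎ Below K ⊎ Below (suc K)
    to : UState → Code
    to convert = inj₁ tt
    to rewindInput = inj₂ (inj₁ tt)
    to finish = inj₂ (inj₂ (inj₁ tt))
    to done = inj₂ (inj₂ (inj₂ (inj₁ tt)))
    to (emit j r) = inj₂ (inj₂ (inj₂ (inj₂ (inj₁ (j , r)))))
    to (toOutputEnd j r) = inj₂ (inj₂ (inj₂ (inj₂ (inj₂ (inj₁ (j , r))))))
    to (toHash j r) = inj₂ (inj₂ (inj₂ (inj₂ (inj₂ (inj₂ (inj₁ (j , r)))))))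
    to (loop j) = inj₂ (inj₂ (inj₂ (inj₂ (inj₂ (inj₂ (inj₂ (inj₁ j)))))))
    to (seek j) = inj₂ (inj₂ (inj₂ (inj₂ (inj₂ (inj₂ (inj₂ (inj₂ (inj₁ j))))))))
    to (back j) = inj₂ (inj₂ (inj₂ (inj₂ (inj₂ (inj₂ (inj₂ (inj₂ (inj₂ (inj₁ j)))))))))
    to (clear j) = inj₂ (inj₂ (inj₂ (inj₂ (inj₂ (inj₂ (inj₂ (inj₂ (inj₂ (inj₂ (inj₁ j))))))))))
    to (ret j) = inj₂ (inj₂ (inj₂ (inj₂ (inj₂ (inj₂ (inj₂ (inj₂ (inj₂ (inj₂ (inj₂ j))))))))))
    from : Code → UState
    from (inj₁ _) = convert
    from (inj₂ (inj₁ _)) = rewindInput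
    from (inj₂ (inj₂ (inj₁ _))) = finish
    from (inj₂ (inj₂ (inj₂ (inj₁ _)))) = done
    from (inj₂ (inj₂ (inj₂ (inj₂ (inj₁ (j , r)))))) = emit j r
    from (inj₂ (inj₂ (inj₂ (inj₂ (inj₂ (inj₁ (j , r))))))) = toOutputEnd j r
    from (inj₂ (inj₂ (inj₂ (inj₂ (inj₂ (inj₂ (inj₁ (j , r)))))))) = toHash j r
    from (inj₂ (inj₂ (inj₂ (inj₂ (inj₂ (inj₂ (inj₂ (inj₁ j)))))))) = loop j
    from (inj₂ (inj₂ (inj₂ (inj₂ (inj₂ (inj₂ (inj₂ (inj₂ (inj₁ j))))))))) = seek j
    from (inj₂ (inj₂ (inj₂ (inj₂ (inj₂ (inj₂ (inj₂ (inj₂ (inj₂ (inj₁ j)))))))))) = back j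
    from (inj₂ (inj₂ (inj₂ (inj₂ (inj₂ (inj₂ (inj₂ (inj₂ (inj₂ (inj₂ (inj₁ j))))))))))) = clear j
    from (inj₂ (inj₂ (inj₂ (inj₂ (inj₂ (inj₂ (inj₂ (inj₂ (inj₂ (inj₂ (inj₂ j))))))))))) = ret j
    from-to : ∀ q → from (to q) ≡ q
    from-to convert = refl
    from-to rewindInput = refl
    from-to finish = refl
    from-to done = refl
    from-to (emit j r) = refl
    from-to (toOutputEnd j r) = refl
    from-to (toHash j r) = refl
    from-to (loop j) = refl
    from-to (seek j) = refl
    from-to (back j) = refl
    from-to (clear j) = refl
    from-to (ret j) = refl

  writes-FPt : FPt (uniformPath p v)
  writes-FPt = Compile.computes unaryMachine stateCode tallyCode _ (proj₁ unaryTime-bounded) λ x →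
    halts-mono (proj₂ unaryTime-bounded (length x))
      (subst (λ out → HaltsWithin (unaryTime (length x)) (initial x) (λ c → bits (right c) ≡ out))
        (sym (toList-replicate (evalP p (length x)) v)) (writes x))

open LexSuccessorMachine using (lexPrec-PolyTimeDec)

identity-adjacency : ∀ V f x {m} → Adjacency V lexPrec f x (↔-id (Vec Bool m))
identity-adjacency V f x y z = subst (λ b → (b ≡ true) ⇔ LexSucc y z) (sym (lexPrec-triple x (toList y) (toList z))) (isLexSucc⇔LexSucc y z)

identity-cluster : ∀ V prec f x {m} → f x ≡ 0 ⊎ f x ≡ 1 → Counts V prec f x (↔-id (Vec Bool m)) → Cluster V prec f x (↔-id (Vec Bool m))
identity-cluster V prec f x {m} (inj₁ none) _ nonzero = contradiction none nonzero
identity-cluster V prec f x {m} (inj₂ one) counts _ =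
  let (w₀ , only-w₀) = unique-accepting-path V x m (trans (sym counts) one) in w₀ , w₀ , only-w₀

theorem5p3 : ∀ (f : Str → ℕ) →
    (CLUSharpPfree f × ZeroOneF f) ⇔ (CLUSharpP f × ZeroOneF f)
theorem5p3 f = mk⇔ add-endpoints forget-endpoints
  where
  add-endpoints : CLUSharpPfree f × ZeroOneF f → CLUSharpP f × ZeroOneF f
  add-endpoints ((p , V , V-ptime , _ , _ , witness) , zero-one) =
    (p , V , V-ptime , uniformPath p false , UnaryMachine.writes-FPt p false , uniformPath p true , UnaryMachine.writes-FPt p true ,
     lexPrec , lexPrec-PolyTimeDec ,
     λ x → let (_ , _ , _ , counts) = witness x in
       ↔-id _ , (replicate _ false , refl , refl) , (replicate _ true , refl , refl) ,
       identity-adjacency V f x , identity-cluster V lexPrec f x (zero-one x) counts , counts) ,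
    zero-one
  forget-endpoints : CLUSharpP f × ZeroOneF f → CLUSharpPfree f × ZeroOneF f
  forget-endpoints ((p , V , V-ptime , _ , _ , _ , _ , prec , prec-ptime , witness) , zero-one) =
    (p , V , V-ptime , prec , prec-ptime , λ x → let (h , _ , _ , rest) = witness x in h , rest) , zero-one
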